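{- If $n\ge 3$, then $\mathrm{mob}(C_n\odot K_1)=\left\lceil n/2\right\rceil+1$.
   Context: $C_n$ is the cycle on $n$ vertices. For graphs $G$ with $V(G)=\{v_1,\dots,v_n\}$ and $H$, the corona product $G\odot H$ is obtained from one copy of $G$ and $n$ disjoint copies $H^1,\dots,H^n$ of $H$ by joining $v_i$ to every vertex of $H^i$ (so $C_n\odot K_1$ is $C_n$ with one pendant leaf attached to each vertex). A set $S\subseteq V(G)$ is a general position set if no three vertices of $S$ lie on a common shortest path. Robots are placed one per vertex of a general position set $S$; a move $u\to v$ along an edge $uv$ with $u\in S$ is legal if $v\notin S$ and $(S\setminus\{u\})\cup\{v\}$ is a general position set. $S$ is a mobile general position set if some sequence of legal moves starting from $S$ visits every vertex at least once; $\mathrm{mob}(G)$ is the maximum size of a mobile general position set. -}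

module Defs where

open import Data.Nat using (ℕ; zero; suc; _+_; _∸_; _≤_)
open import Data.Fin using (Fin; toℕ; splitAt)
open import Data.Fin.Subset using (Subset; _∈_; _∉_; ∣_∣; inside; outside)
open import Data.Vec using (_[_]≔_)
open import Data.List using (List; []; _∷_)
open import Data.List.Relation.Unary.Any using (Any)
open import Data.Product using (Σ; ∃; _×_; _,_)
open import Data.Sum using (_⊎_; inj₁; inj₂)
open import Data.Empty using (⊥)
open import Relation.Nullary using (¬_)
open import Relation.Binary.PropositionalEquality using (_≡_; _≢_)

record Graph : Set₁ where
  field
    V   : ℕ
    Adj : Fin V → Fin V → Set
open Graph public

module _ (G : Graph) where

  data Walk : Fin (V G) → Fin (V G) → Set where
    nil  : ∀ u → Walk u u
    cons : ∀ {u w v} → Adj G u w → Walk w v → Walk u v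

  len : ∀ {u v} → Walk u v → ℕ
  len (nil _)    = 0
  len (cons _ p) = suc (len p)

  data OnWalk (x : Fin (V G)) : ∀ {u v} → Walk u v → Set where
    here-nil  : OnWalk x (nil x)
    here-cons : ∀ {w v} (a : Adj G x w) (p : Walk w v) → OnWalk x (cons a p)
    there     : ∀ {u w v} (a : Adj G u w) {p : Walk w v} → OnWalk x p → OnWalk x (cons a p)

  IsShortest : ∀ {u v} → Walk u v → Set
  IsShortest {u} {v} p = ∀ (q : Walk u v) → len p ≤ len q

  IsGeneralPosition : Subset (V G) → Set
  IsGeneralPosition S =
    ∀ x y z → x ∈ S → y ∈ S → z ∈ S → x ≢ y → y ≢ z → x ≢ z →
    ¬ (Σ (Fin (V G)) λ u → Σ (Fin (V G)) λ v → Σ (Walk u v) λ p →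
         IsShortest p × OnWalk x p × OnWalk y p × OnWalk z p)

  LegalMove : Subset (V G) → Subset (V G) → Set
  LegalMove S S' = Σ (Fin (V G)) λ u → Σ (Fin (V G)) λ v →
    Adj G u v × u ∈ S × v ∉ S ×
    S' ≡ ((S [ u ]≔ outside) [ v ]≔ inside) × IsGeneralPosition S'

  data MoveSeq : Subset (V G) → List (Subset (V G)) → Set where
    done : ∀ S → MoveSeq S (S ∷ [])
    step : ∀ {S S' L} → LegalMove S S' → MoveSeq S' L → MoveSeq S (S ∷ L)

  IsMobileGP : Subset (V G) → Set
  IsMobileGP S = IsGeneralPosition S ×
    Σ (List (Subset (V G))) λ L → MoveSeq S L ×
      (∀ (x : Fin (V G)) → Any (λ T → x ∈ T) L)

  MobEq : ℕ → Set
  MobEq k = (Σ (Subset (V G)) λ S → IsMobileGP S × ∣ S ∣ ≡ k) ×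
            (∀ S → IsMobileGP S → ∣ S ∣ ≤ k)

CycAdj₀ : (n : ℕ) → Fin n → Fin n → Set
CycAdj₀ n i j = (suc (toℕ i) ≡ toℕ j) ⊎ (toℕ i ≡ n ∸ 1 × toℕ j ≡ 0)

CycAdj : (n : ℕ) → Fin n → Fin n → Set
CycAdj n i j = (CycAdj₀ n i j ⊎ CycAdj₀ n j i) × i ≢ j

-- Corona C_n ⊙ K_1 on Fin (n + n): the first n vertices (splitAt = inj₁ i) form
-- the cycle, vertex inj₂ i is the pendant leaf attached to cycle vertex i.
CoronaAdj' : (n : ℕ) → Fin n ⊎ Fin n → Fin n ⊎ Fin n → Set
CoronaAdj' n (inj₁ i) (inj₁ j) = CycAdj n i j
CoronaAdj' n (inj₁ i) (inj₂ j) = i ≡ j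
CoronaAdj' n (inj₂ i) (inj₁ j) = i ≡ j
CoronaAdj' n (inj₂ i) (inj₂ j) = ⊥

CnCoronaK1 : ℕ → Graph
CnCoronaK1 n = record { V = n + n ; Adj = λ u v → CoronaAdj' n (splitAt n u) (splitAt n v) }

{-# OPTIONS --safe #-}
module Submission where

-- Write h = ⌈n/2⌉ and cᵢ, ℓᵢ for the cycle vertices and their leaves. A leaf never lies strictly
-- between two other vertices on a geodesic, so only cycle vertices can spoil general position.
--
-- Measure positions on the cycle from a rotating origin ("phase" a). The h + 1 leaves
-- at positions 0, …, h are in general position. The robot on the leaf at position h steps down to
-- the cycle and walks along positions h + 1, …, n − 1: since the remaining leaves occupy the arc
-- 0, …, h − 1 of length less than n/2, the walking robot is never between two of them. It then
-- climbs to the leaf at position n − 1, which is position 0 of the next phase. After n phases every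
-- vertex has been occupied.
--
-- Some configuration of a mobile set occupies c₀, so it suffices to bound general
-- position sets T ∋ c₀. If ℓ₀ ∈ T, then c₀ lies between ℓ₀ and anything else, so |T| = 2. Otherwise
-- every position i ≠ 0 carries at most one vertex of T (c₀, cᵢ, ℓᵢ lie on a geodesic), and the
-- positions i and i + h are not both occupied because c₀ lies between them when n ≤ 2h; this
-- leaves room for at most h vertices besides c₀.

open import Defs
open import Data.Bool.Base using (Bool; true; false; if_then_else_)
open import Data.Empty using (⊥; ⊥-elim)
open import Data.Fin as Fin using (Fin; toℕ; fromℕ<; splitAt; join; _↑ˡ_; _↑ʳ_)
open import Data.Fin.Properties using (toℕ-injective; toℕ-fromℕ<; toℕ<n; splitAt-join; join-splitAt)
open import Data.Fin.Subset using (Subset; _∈_; _∉_; ∣_∣; inside; outside)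
open import Data.Fin.Subset.Properties using (_∈?_)
open import Data.List.Base using (List; []; _∷_; _++_)
open import Data.List.Membership.Propositional using () renaming (_∈_ to _∈ₗ_)
open import Data.List.Relation.Unary.Any as Any using (Any; here; there)
open import Data.List.Relation.Unary.Any.Properties using (++⁺ʳ)
open import Data.Nat
open import Data.Nat.DivMod
open import Data.Nat.Properties
open import Data.Nat.Tactic.RingSolver using (solve; solve-∀)
open import Data.Product.Base using (Σ; _×_; _,_; proj₁; proj₂)
open import Data.Sum.Base using (_⊎_; inj₁; inj₂; [_,_]′)
open import Data.Sum.Properties using (inj₁-injective; ≡-dec)
open import Data.Vec.Base as Vec using (tabulate; lookup; _[_]≔_)
open import Data.Vec.Properties
  using ([]=⇒lookup; lookup⇒[]=; lookup∘tabulate; tabulate∘lookup; tabulate-cong; lookup∘update; lookup∘update′)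
open import Function.Base using (_∘_)
open import Function.Bundles using (_⇔_; mk⇔)
open import Relation.Nullary using (¬_; Dec; yes; no; does)
open import Relation.Nullary.Decidable using (dec-true; dec-false; does-⇔)
open import Relation.Binary.PropositionalEquality

open import Algebra.Properties.CommutativeMonoid.Sum +-0-commutativeMonoid using (sum-syntax; ∑-distrib-+; sum-cong-≗)
open import Algebra.Properties.CommutativeSemigroup +-commutativeSemigroup using (xy∙z≈xz∙y)

-- Walks, geodesics and general position

module Walks (G : Graph) where

  infixr 5 _++ʷ_

  _++ʷ_ : ∀ {u w v} → Walk G u w → Walk G w v → Walk G u v
  nil _    ++ʷ q = q
  cons a p ++ʷ q = cons a (p ++ʷ q)

  length-++ʷ : ∀ {u w v} (p : Walk G u w) (q : Walk G w v) → len G (p ++ʷ q) ≡ len G p + len G q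
  length-++ʷ (nil _)    q = refl
  length-++ʷ (cons a p) q = cong suc (length-++ʷ p q)

  onWalk-start : ∀ {u v} (p : Walk G u v) → OnWalk G u p
  onWalk-start (nil u)    = here-nil
  onWalk-start (cons a p) = here-cons a p

  onWalk-end : ∀ {u v} (p : Walk G u v) → OnWalk G v p
  onWalk-end (nil u)    = here-nil
  onWalk-end (cons a p) = there a (onWalk-end p)

  onWalk-++ˡ : ∀ {x u w v} (p : Walk G u w) (q : Walk G w v) → OnWalk G x p → OnWalk G x (p ++ʷ q)
  onWalk-++ˡ (nil _)    q here-nil            = onWalk-start q
  onWalk-++ˡ (cons a p) q (here-cons .a .p) = here-cons a (p ++ʷ q)
  onWalk-++ˡ (cons a p) q (there .a x∈p)    = there a (onWalk-++ˡ p q x∈p)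

  onWalk-++ʳ : ∀ {x u w v} (p : Walk G u w) (q : Walk G w v) → OnWalk G x q → OnWalk G x (p ++ʷ q)
  onWalk-++ʳ (nil _)    q x∈q = x∈q
  onWalk-++ʳ (cons a p) q x∈q = there a (onWalk-++ʳ p q x∈q)

  module _ (Adj-sym : ∀ {a b} → Adj G a b → Adj G b a) where

    reverse : ∀ {u v} → Walk G u v → Walk G v u
    reverse (nil u)    = nil u
    reverse (cons a p) = reverse p ++ʷ cons (Adj-sym a) (nil _)

    length-reverse : ∀ {u v} (p : Walk G u v) → len G (reverse p) ≡ len G p
    length-reverse (nil u)    = refl
    length-reverse (cons a p) = trans (length-++ʷ (reverse p) _) (trans (+-comm _ 1) (cong suc (length-reverse p)))

  record Cut {u v} (p : Walk G u v) (x : Fin (V G)) : Set where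
    constructor mkCut
    field
      prefix       : Walk G u x
      suffix       : Walk G x v
      length-sum   : len G prefix + len G suffix ≡ len G p
      onWalk-split : ∀ {y} → OnWalk G y p → OnWalk G y prefix ⊎ OnWalk G y suffix

  cut : ∀ {u v x} (p : Walk G u v) → OnWalk G x p → Cut p x
  cut (nil x)    here-nil          = mkCut (nil x) (nil x) refl inj₁
  cut (cons a p) (here-cons .a .p) = mkCut (nil _) (cons a p) refl inj₂
  cut (cons a p) (there .a x∈p) with cut p x∈p
  ... | mkCut s t s+t y∈s⊎t = mkCut (cons a s) t (cong suc s+t) split
    where
    split : ∀ {y} → OnWalk G y (cons a p) → OnWalk G y (cons a s) ⊎ OnWalk G y t
    split (here-cons .a .p) = inj₁ (here-cons a s)
    split (there .a y∈p) with y∈s⊎t y∈p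
    ... | inj₁ y∈s = inj₁ (there a y∈s)
    ... | inj₂ y∈t = inj₂ y∈t

  record Passes₂ {u v} (p : Walk G u v) (a b : Fin (V G)) : Set where
    constructor mkPasses₂
    field
      s : Walk G u a
      q : Walk G a b
      t : Walk G b v
      length-sum   : len G s + len G q + len G t ≡ len G p
      onWalk-split : ∀ {y} → OnWalk G y p → OnWalk G y s ⊎ OnWalk G y q ⊎ OnWalk G y t

  record Passes₃ {u v} (p : Walk G u v) (a b c : Fin (V G)) : Set where
    constructor mkPasses₃
    field
      s : Walk G u a
      q : Walk G a b
      r : Walk G b c
      t : Walk G c v
      length-sum : len G s + len G q + len G r + len G t ≡ len G p

  passes₂ : ∀ {u v a b} {p : Walk G u v} → OnWalk G a p → OnWalk G b p → Passes₂ p a b ⊎ Passes₂ p b a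
  passes₂ {p = p} a∈p b∈p with cut p a∈p
  ... | mkCut s t s+t y∈s⊎t with y∈s⊎t b∈p
  ... | inj₂ b∈t with cut t b∈t
  ...   | mkCut t₁ t₂ t₁+t₂ y∈t₁⊎t₂ = inj₁ (mkPasses₂ s t₁ t₂ total split)
    where
    total : len G s + len G t₁ + len G t₂ ≡ len G p
    total = trans (+-assoc (len G s) _ _) (trans (cong (len G s +_) t₁+t₂) s+t)
    split : ∀ {y} → OnWalk G y p → OnWalk G y s ⊎ OnWalk G y t₁ ⊎ OnWalk G y t₂
    split y∈p with y∈s⊎t y∈p
    ... | inj₁ y∈s = inj₁ y∈s
    ... | inj₂ y∈t with y∈t₁⊎t₂ y∈t
    ...   | inj₁ y∈t₁ = inj₂ (inj₁ y∈t₁)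
    ...   | inj₂ y∈t₂ = inj₂ (inj₂ y∈t₂)
  passes₂ {p = p} a∈p b∈p | mkCut s t s+t y∈s⊎t | inj₁ b∈s with cut s b∈s
  ...   | mkCut s₁ s₂ s₁+s₂ y∈s₁⊎s₂ = inj₂ (mkPasses₂ s₁ s₂ t (trans (cong (_+ len G t) s₁+s₂) s+t) split)
    where
    split : ∀ {y} → OnWalk G y p → OnWalk G y s₁ ⊎ OnWalk G y s₂ ⊎ OnWalk G y t
    split y∈p with y∈s⊎t y∈p
    ... | inj₂ y∈t = inj₂ (inj₂ y∈t)
    ... | inj₁ y∈s with y∈s₁⊎s₂ y∈s
    ...   | inj₁ y∈s₁ = inj₁ y∈s₁
    ...   | inj₂ y∈s₂ = inj₂ (inj₁ y∈s₂)

  passes₃ : ∀ {u v a b c} {p : Walk G u v} → Passes₂ p a b → OnWalk G c p →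
            Passes₃ p c a b ⊎ Passes₃ p a c b ⊎ Passes₃ p a b c
  passes₃ (mkPasses₂ s q t total split) c∈p with split c∈p
  ... | inj₁ c∈s with cut s c∈s
  ...   | mkCut s₁ s₂ s₁+s₂ _ =
          inj₁ (mkPasses₃ s₁ s₂ q t (trans (cong (λ m → m + len G q + len G t) s₁+s₂) total))
  passes₃ (mkPasses₂ s q t total split) c∈p | inj₂ (inj₁ c∈q) with cut q c∈q
  ...   | mkCut q₁ q₂ q₁+q₂ _ = inj₂ (inj₁ (mkPasses₃ s q₁ q₂ t
          (trans (cong (_+ len G t) (trans (+-assoc (len G s) _ _) (cong (len G s +_) q₁+q₂))) total)))
  passes₃ (mkPasses₂ s q t total split) c∈p | inj₂ (inj₂ c∈t) with cut t c∈t
  ...   | mkCut t₁ t₂ t₁+t₂ _ = inj₂ (inj₂ (mkPasses₃ s q t₁ t₂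
          (trans (trans (+-assoc (len G s + len G q) _ _) (cong (len G s + len G q +_) t₁+t₂)) total)))

  infix-isShortest : ∀ {u a b v} {p : Walk G u v} (s : Walk G u a) (q : Walk G a b) (t : Walk G b v) →
    IsShortest G p → len G s + len G q + len G t ≡ len G p → IsShortest G q
  infix-isShortest {p = p} s q t p-shortest total q′ =
    +-cancelʳ-≤ (len G t) (len G q) (len G q′) (+-cancelˡ-≤ (len G s) _ _ (begin
      len G s + (len G q + len G t)   ≡⟨ +-assoc (len G s) _ _ ⟨
      len G s + len G q + len G t     ≡⟨ total ⟩
      len G p                         ≤⟨ p-shortest (s ++ʷ q′ ++ʷ t) ⟩
      len G (s ++ʷ q′ ++ʷ t)          ≡⟨ length-++ʷ s _ ⟩
      len G s + len G (q′ ++ʷ t)      ≡⟨ cong (len G s +_) (length-++ʷ q′ t) ⟩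
      len G s + (len G q′ + len G t)  ∎))
    where open ≤-Reasoning

module Distance (G : Graph) (d : Fin (V G) → Fin (V G) → ℕ)
  (d≤len : ∀ {u v} (p : Walk G u v) → d u v ≤ len G p)
  (d-attained : ∀ u v → Σ (Walk G u v) λ p → len G p ≤ d u v) where

  open Walks G

  Between : Fin (V G) → Fin (V G) → Fin (V G) → Set
  Between a b c = d a c ≡ d a b + d b c

  d-triangle : ∀ a b c → d a c ≤ d a b + d b c
  d-triangle a b c with d-attained a b | d-attained b c
  ... | p , p≤ | q , q≤ = begin
    d a c                  ≤⟨ d≤len (p ++ʷ q) ⟩
    len G (p ++ʷ q)        ≡⟨ length-++ʷ p q ⟩
    len G p + len G q      ≤⟨ +-mono-≤ p≤ q≤ ⟩
    d a b + d b c          ∎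
    where open ≤-Reasoning

  isShortest⇒len≡d : ∀ {a b} {q : Walk G a b} → IsShortest G q → len G q ≡ d a b
  isShortest⇒len≡d {a} {b} {q} q-shortest with d-attained a b
  ... | p , p≤ = ≤-antisym (≤-trans (q-shortest p) p≤) (d≤len q)

  passes₃-between : ∀ {u v a b c} {p : Walk G u v} → IsShortest G p → Passes₃ p a b c → Between a b c
  passes₃-between {p = p} p-shortest (mkPasses₃ s q r t total) = begin
    d _ _                  ≡⟨ isShortest⇒len≡d (infix-isShortest s (q ++ʷ r) t p-shortest sum-qr) ⟨
    len G (q ++ʷ r)        ≡⟨ length-++ʷ q r ⟩
    len G q + len G r      ≡⟨ cong₂ _+_ (isShortest⇒len≡d (infix-isShortest s q (r ++ʷ t) p-shortest sum-q))
                                        (isShortest⇒len≡d (infix-isShortest (s ++ʷ q) r t p-shortest sum-r)) ⟩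
    d _ _ + d _ _          ∎
    where
    open ≡-Reasoning
    sum-qr : len G s + len G (q ++ʷ r) + len G t ≡ len G p
    sum-qr = trans (cong (λ m → len G s + m + len G t) (length-++ʷ q r))
                   (trans (cong (_+ len G t) (sym (+-assoc (len G s) (len G q) (len G r)))) total)
    sum-q : len G s + len G q + len G (r ++ʷ t) ≡ len G p
    sum-q = trans (cong (len G s + len G q +_) (length-++ʷ r t))
                  (trans (sym (+-assoc (len G s + len G q) (len G r) (len G t))) total)
    sum-r : len G (s ++ʷ q) + len G r + len G t ≡ len G p
    sum-r = trans (cong (λ m → m + len G r + len G t) (length-++ʷ s q)) total

  generalPosition-if-noneBetween : (S : Subset (V G)) →
    (∀ {x y z} → x ∈ S → y ∈ S → z ∈ S → x ≢ y → y ≢ z → x ≢ z → ¬ Between x y z) →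
    IsGeneralPosition G S
  generalPosition-if-noneBetween S noneBetween x y z x∈S y∈S z∈S x≢y y≢z x≢z
    (_ , _ , p , p-shortest , x∈p , y∈p , z∈p) =
    [ excluded x∈S y∈S x≢y y≢z x≢z , excluded y∈S x∈S (≢-sym x≢y) x≢z y≢z ]′ (passes₂ x∈p y∈p)
    where
    excluded : ∀ {a b} → a ∈ S → b ∈ S → a ≢ b → b ≢ z → a ≢ z → Passes₂ p a b → ⊥
    excluded a∈S b∈S a≢b b≢z a≢z ab with passes₃ ab z∈p
    ... | inj₁ zab        = noneBetween z∈S a∈S b∈S (≢-sym a≢z) a≢b (≢-sym b≢z) (passes₃-between p-shortest zab)
    ... | inj₂ (inj₁ azb) = noneBetween a∈S z∈S b∈S a≢z (≢-sym b≢z) a≢b (passes₃-between p-shortest azb)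
    ... | inj₂ (inj₂ abz) = noneBetween a∈S b∈S z∈S a≢b b≢z a≢z (passes₃-between p-shortest abz)

  ¬generalPosition-if-between : (S : Subset (V G)) → ∀ {x y z} → x ∈ S → y ∈ S → z ∈ S →
    x ≢ y → y ≢ z → x ≢ z → d x y + d y z ≤ d x z → ¬ IsGeneralPosition G S
  ¬generalPosition-if-between S {x} {y} {z} x∈S y∈S z∈S x≢y y≢z x≢z y-between S-gp
    with d-attained x y | d-attained y z
  ... | p , p≤ | q , q≤ = S-gp x y z x∈S y∈S z∈S x≢y y≢z x≢z
    (x , z , p ++ʷ q , pq-shortest , onWalk-start (p ++ʷ q) ,
     onWalk-++ˡ p q (onWalk-end p) , onWalk-++ʳ p q (onWalk-end q))
    where
    pq-shortest : IsShortest G (p ++ʷ q)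
    pq-shortest r = begin
      len G (p ++ʷ q)    ≡⟨ length-++ʷ p q ⟩
      len G p + len G q  ≤⟨ +-mono-≤ p≤ q≤ ⟩
      d x y + d y z      ≤⟨ y-between ⟩
      d x z              ≤⟨ d≤len r ⟩
      len G r            ∎
      where open ≤-Reasoning

-- Legal moves

fromBool : Bool → ℕ
fromBool true  = 1
fromBool false = 0

fromBool≤1 : ∀ b → fromBool b ≤ 1
fromBool≤1 true  = ≤-refl
fromBool≤1 false = z≤n

∉⇒lookup≡outside : ∀ {k} {i : Fin k} {p : Subset k} → i ∉ p → lookup p i ≡ outside
∉⇒lookup≡outside {i = i} {p} i∉p with lookup p i in eq
... | inside  = ⊥-elim (i∉p (lookup⇒[]= i p eq))
... | outside = refl

∣[]≔∣ : ∀ {k} (p : Subset k) i b → ∣ p [ i ]≔ b ∣ + fromBool (lookup p i) ≡ ∣ p ∣ + fromBool b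
∣[]≔∣ (inside Vec.∷ p) Fin.zero    inside  = refl
∣[]≔∣ (inside Vec.∷ p) Fin.zero    outside = trans (+-comm ∣ p ∣ 1) (sym (+-identityʳ _))
∣[]≔∣ (outside Vec.∷ p) Fin.zero    inside  = trans (+-identityʳ _) (+-comm 1 ∣ p ∣)
∣[]≔∣ (outside Vec.∷ p) Fin.zero    outside = refl
∣[]≔∣ (inside Vec.∷ p) (Fin.suc i) b       = cong suc (∣[]≔∣ p i b)
∣[]≔∣ (outside Vec.∷ p) (Fin.suc i) b       = ∣[]≔∣ p i b

dec-true⁻¹ : ∀ {A : Set} (a? : Dec A) → does a? ≡ true → A
dec-true⁻¹ (yes a) _ = a

module Moves (G : Graph) where

  legalMove-size : ∀ {S S′} → LegalMove G S S′ → ∣ S′ ∣ ≡ ∣ S ∣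
  legalMove-size {S} (u , v , _ , u∈S , v∉S , refl , _) = begin
    ∣ S₁ [ v ]≔ inside ∣                        ≡⟨ +-identityʳ _ ⟨
    ∣ S₁ [ v ]≔ inside ∣ + 0                    ≡⟨ cong (λ b → ∣ S₁ [ v ]≔ inside ∣ + fromBool b) v-outside ⟨
    ∣ S₁ [ v ]≔ inside ∣ + fromBool (lookup S₁ v) ≡⟨ ∣[]≔∣ S₁ v inside ⟩
    ∣ S₁ ∣ + 1                                  ≡⟨ cong (λ b → ∣ S₁ ∣ + fromBool b) ([]=⇒lookup u∈S) ⟨
    ∣ S₁ ∣ + fromBool (lookup S u)              ≡⟨ ∣[]≔∣ S u outside ⟩
    ∣ S ∣ + 0                                   ≡⟨ +-identityʳ _ ⟩
    ∣ S ∣                                       ∎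
    where
    open ≡-Reasoning
    S₁ = S [ u ]≔ outside
    v-outside : lookup S₁ v ≡ outside
    v-outside = trans (lookup∘update′ (λ { refl → v∉S u∈S }) S outside) (∉⇒lookup≡outside v∉S)

  moveSeq-head : ∀ {S L} → MoveSeq G S L → ∀ {P : Subset (V G) → Set} → P S → Any P L
  moveSeq-head (done _)   PS = here PS
  moveSeq-head (step _ _) PS = here PS

  visited-configuration : ∀ {S L} → MoveSeq G S L → IsGeneralPosition G S →
    ∀ {P : Subset (V G) → Set} → Any P L →
    Σ (Subset (V G)) λ T → P T × IsGeneralPosition G T × ∣ T ∣ ≡ ∣ S ∣
  visited-configuration {S} (done _)   S-gp (here PS) = S , PS , S-gp , refl
  visited-configuration {S} (step _ _) S-gp (here PS) = S , PS , S-gp , refl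
  visited-configuration (step move@(_ , _ , _ , _ , _ , _ , S′-gp) moves) _ (there P∈L)
    with visited-configuration moves S′-gp P∈L
  ... | T , PT , T-gp , ∣T∣≡∣S′∣ = T , PT , T-gp , trans ∣T∣≡∣S′∣ (legalMove-size move)

  mobile-size-bound : ∀ x k → (∀ T → IsGeneralPosition G T → x ∈ T → ∣ T ∣ ≤ k) →
    ∀ S → IsMobileGP G S → ∣ S ∣ ≤ k
  mobile-size-bound x k bound S (S-gp , L , moves , visits) with visited-configuration moves S-gp (visits x)
  ... | T , x∈T , T-gp , ∣T∣≡∣S∣ = subst (_≤ k) ∣T∣≡∣S∣ (bound T T-gp x∈T)

-- Finite sums

∣p∣≡∑ : ∀ {k} (p : Subset k) → ∣ p ∣ ≡ ∑[ i < k ] fromBool (lookup p i)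
∣p∣≡∑ Vec.[]           = refl
∣p∣≡∑ (inside Vec.∷ p) = cong suc (∣p∣≡∑ p)
∣p∣≡∑ (outside Vec.∷ p) = ∣p∣≡∑ p

∑-split : ∀ k l (g : ℕ → ℕ) → ∑[ i < k + l ] g (toℕ i) ≡ ∑[ i < k ] g (toℕ i) + ∑[ i < l ] g (k + toℕ i)
∑-split zero    l g = refl
∑-split (suc k) l g = trans (cong (g 0 +_) (∑-split k l (g ∘ suc))) (sym (+-assoc (g 0) _ _))

∑-≤ : ∀ {k c} (g : Fin k → ℕ) → (∀ i → g i ≤ c) → ∑[ i < k ] g i ≤ k * c
∑-≤ {zero}  g g≤c = z≤n
∑-≤ {suc k} g g≤c = +-mono-≤ (g≤c _) (∑-≤ (λ i → g (Fin.suc i)) (λ i → g≤c _))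

∑-pairing≤ : ∀ {m h} (g : ℕ → ℕ) → h ≤ m → m ≤ h + h →
  (∀ j → j < m → g j ≤ 1) → (∀ j → h + j < m → g j + g (h + j) ≤ 1) →
  ∑[ i < m ] g (toℕ i) ≤ h
∑-pairing≤ {m} {h} g h≤m m≤2h g≤1 pair≤1 with m≤n⇒∃[o]m+o≡n h≤m
... | p , refl with m≤n⇒∃[o]m+o≡n (+-cancelˡ-≤ h p h m≤2h)
... | q , refl = begin
  ∑[ i < p + q + p ] g (toℕ i)                              ≡⟨ ∑-split (p + q) p g ⟩
  ∑[ i < p + q ] g (toℕ i) + ∑[ i < p ] g (p + q + toℕ i)
                                                            ≡⟨ cong (_+ ∑[ i < p ] g (p + q + toℕ i)) (∑-split p q g) ⟩
  ∑[ i < p ] g (toℕ i) + ∑[ i < q ] g (p + toℕ i) + ∑[ i < p ] g (p + q + toℕ i)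
                                                            ≡⟨ xy∙z≈xz∙y (∑[ i < p ] g (toℕ i)) _ _ ⟩
  ∑[ i < p ] g (toℕ i) + ∑[ i < p ] g (p + q + toℕ i) + ∑[ i < q ] g (p + toℕ i)
                                                            ≡⟨ cong (_+ ∑[ i < q ] g (p + toℕ i)) ∑-pairs ⟨
  ∑[ i < p ] (g (toℕ i) + g (p + q + toℕ i)) + ∑[ i < q ] g (p + toℕ i)
                                                            ≤⟨ +-mono-≤ (∑-≤ _ pairs) (∑-≤ _ middle) ⟩
  p * 1 + q * 1                                             ≡⟨ cong₂ _+_ (*-identityʳ p) (*-identityʳ q) ⟩
  p + q                                                     ∎
  where
  open ≤-Reasoning
  ∑-pairs : ∑[ i < p ] (g (toℕ i) + g (p + q + toℕ i)) ≡ ∑[ i < p ] g (toℕ i) + ∑[ i < p ] g (p + q + toℕ i)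
  ∑-pairs = ∑-distrib-+ {p} (g ∘ toℕ) (λ i → g (p + q + toℕ i))
  pairs : ∀ (i : Fin p) → g (toℕ i) + g (p + q + toℕ i) ≤ 1
  pairs i = pair≤1 (toℕ i) (+-monoʳ-< (p + q) (toℕ<n i))
  middle : ∀ (i : Fin q) → g (p + toℕ i) ≤ 1
  middle i = g≤1 (p + toℕ i) (<-≤-trans (+-monoʳ-< p (toℕ<n i)) (m≤m+n (p + q) p))

∑-↑-split : ∀ m {k} (f : Fin (m + k) → ℕ) →
  ∑[ i < m + k ] f i ≡ ∑[ i < m ] f (i ↑ˡ k) + ∑[ i < k ] f (m ↑ʳ i)
∑-↑-split zero    f = refl
∑-↑-split (suc m) f = trans (cong (f Fin.zero +_) (∑-↑-split m (f ∘ Fin.suc))) (sym (+-assoc (f Fin.zero) _ _))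

∑-peel : ∀ {m} (g : ℕ → ℕ) → 0 < m → ∑[ i < m ] g (toℕ i) ≡ g 0 + ∑[ i < m ∸ 1 ] g (suc (toℕ i))
∑-peel {suc m} g _ = refl

∑-zero : ∀ {k} (g : Fin k → ℕ) → (∀ i → g i ≡ 0) → ∑[ i < k ] g i ≡ 0
∑-zero {k} g g≡0 = n≤0⇒n≡0 (≤-trans (∑-≤ {k} {0} g (≤-reflexive ∘ g≡0)) (≤-reflexive (*-zeroʳ k)))

∑-indicator≤ : ∀ {m b} → b < m → ∑[ i < m ] fromBool (does (toℕ i ≤? b)) ≡ suc b
∑-indicator≤ {suc m} {zero}  _   = cong suc (∑-zero {m} _ (λ _ → refl))
∑-indicator≤ {suc m} {suc b} b<m = cong suc (trans
  (sum-cong-≗ {m} λ i → cong fromBool (does-⇔ (mk⇔ s≤s⁻¹ s≤s) (suc (toℕ i) ≤? suc b) (toℕ i ≤? b)))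
  (∑-indicator≤ (s≤s⁻¹ b<m)))

-- Distances on a cycle

m≡n+o⇒m∸n≡o : ∀ {m} n {o} → m ≡ n + o → m ∸ n ≡ o
m≡n+o⇒m∸n≡o n {o} refl = m+n∸m≡n n o

cycNorm : ℕ → ℕ → ℕ
cycNorm n x = x ⊓ (n ∸ x)

cycDist : ℕ → ℕ → ℕ → ℕ
cycDist n a b = cycNorm n ∣ a - b ∣

cycNorm-flip : ∀ {n x} → x ≤ n → cycNorm n (n ∸ x) ≡ cycNorm n x
cycNorm-flip {n} {x} x≤n = trans (cong ((n ∸ x) ⊓_) (m∸[m∸n]≡n x≤n)) (⊓-comm (n ∸ x) x)

n∸m≤1+n∸[1+m] : ∀ n m → n ∸ m ≤ suc (n ∸ suc m)
n∸m≤1+n∸[1+m] zero    m       = ≤-trans (≤-reflexive (0∸n≡0 m)) z≤n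
n∸m≤1+n∸[1+m] (suc n) zero    = ≤-refl
n∸m≤1+n∸[1+m] (suc n) (suc m) = n∸m≤1+n∸[1+m] n m

cycNorm-step : ∀ {n x y} → x ≤ suc y → y ≤ suc x → cycNorm n x ≤ suc (cycNorm n y)
cycNorm-step {n} {x} {y} x≤1+y y≤1+x = ⊓-mono-≤ x≤1+y (begin
  n ∸ x               ≤⟨ n∸m≤1+n∸[1+m] n x ⟩
  suc (n ∸ suc x)     ≤⟨ s≤s (∸-monoʳ-≤ n y≤1+x) ⟩
  suc (n ∸ y)         ∎)
  where open ≤-Reasoning

cycDist-refl : ∀ n a → cycDist n a a ≡ 0
cycDist-refl n a rewrite ∣n-n∣≡0 a = refl

cycDist-sym : ∀ n a b → cycDist n a b ≡ cycDist n b a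
cycDist-sym n a b = cong (cycNorm n) (∣-∣-comm a b)

∣n-1+n∣≡1 : ∀ n → ∣ n - suc n ∣ ≡ 1
∣n-1+n∣≡1 zero    = refl
∣n-1+n∣≡1 (suc n) = ∣n-1+n∣≡1 n

∣m-o∣≤1+∣1+m-o∣ : ∀ a c → ∣ a - c ∣ ≤ suc ∣ suc a - c ∣
∣m-o∣≤1+∣1+m-o∣ a c = begin
  ∣ a - c ∣                          ≤⟨ ∣-∣-triangle a (suc a) c ⟩
  ∣ a - suc a ∣ + ∣ suc a - c ∣      ≡⟨ cong (_+ ∣ suc a - c ∣) (∣n-1+n∣≡1 a) ⟩
  suc ∣ suc a - c ∣                  ∎
  where open ≤-Reasoning

∣1+m-o∣≤1+∣m-o∣ : ∀ a c → ∣ suc a - c ∣ ≤ suc ∣ a - c ∣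
∣1+m-o∣≤1+∣m-o∣ a c = begin
  ∣ suc a - c ∣                      ≤⟨ ∣-∣-triangle (suc a) a c ⟩
  ∣ suc a - a ∣ + ∣ a - c ∣          ≡⟨ cong (_+ ∣ a - c ∣) (trans (∣-∣-comm (suc a) a) (∣n-1+n∣≡1 a)) ⟩
  suc ∣ a - c ∣                      ∎
  where open ≤-Reasoning

CycEdge : ℕ → ℕ → ℕ → Set
CycEdge n a b = (suc a ≡ b) ⊎ (a ≡ n ∸ 1 × b ≡ 0)

cycDist-wrap : ∀ m c → c ≤ m → cycDist (suc m) m c ≡ cycNorm (suc m) (suc c)
cycDist-wrap m c c≤m = begin
  cycNorm (suc m) ∣ m - c ∣                  ≡⟨ cong (cycNorm (suc m)) (m≤n⇒∣n-m∣≡n∸m c≤m) ⟩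
  cycNorm (suc m) (m ∸ c)                    ≡⟨ cycNorm-flip (≤-trans (m∸n≤m m c) (n≤1+n m)) ⟨
  cycNorm (suc m) (suc m ∸ (m ∸ c))          ≡⟨ cong (cycNorm (suc m)) 1+m∸[m∸c]≡1+c ⟩
  cycNorm (suc m) (suc c)                    ∎
  where
  open ≡-Reasoning
  1+m∸[m∸c]≡1+c : suc m ∸ (m ∸ c) ≡ suc c
  1+m∸[m∸c]≡1+c = trans (+-∸-assoc 1 (m∸n≤m m c)) (cong suc (m∸[m∸n]≡n c≤m))

cycDist-edge : ∀ {n a b c} → CycEdge n a b → c < n →
  cycDist n a c ≤ suc (cycDist n b c) × cycDist n b c ≤ suc (cycDist n a c)
cycDist-edge {a = a} {c = c} (inj₁ refl) _ =
  cycNorm-step (∣m-o∣≤1+∣1+m-o∣ a c) (∣1+m-o∣≤1+∣m-o∣ a c) ,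
  cycNorm-step (∣1+m-o∣≤1+∣m-o∣ a c) (∣m-o∣≤1+∣1+m-o∣ a c)
cycDist-edge {suc m} {c = c} (inj₂ (refl , refl)) (s≤s c≤m) rewrite cycDist-wrap m c c≤m =
  cycNorm-step ≤-refl c≤2+c , cycNorm-step c≤2+c ≤-refl
  where c≤2+c = ≤-trans (n≤1+n c) (n≤1+n (suc c))

data Compare≤ (x a : ℕ) : Set where
  below : ∀ p → a ≡ x + p → Compare≤ x a
  above : ∀ s → x ≡ a + suc s → Compare≤ x a

compare≤ : ∀ x a → Compare≤ x a
compare≤ x a with x ≤? a
... | yes x≤a = below (a ∸ x) (sym (m+[n∸m]≡n x≤a))
... | no  x≰a = above (x ∸ suc a) (sym (trans (+-suc a _) (m+[n∸m]≡n (≰⇒> x≰a))))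

reflect : ℕ → ℕ → ℕ → ℕ
reflect n a x with x ≤? a
... | yes _ = a ∸ x
... | no  _ = a + n ∸ x

reflect-≤ : ∀ n a x → x ≤ a → reflect n a x ≡ a ∸ x
reflect-≤ n a x x≤a with x ≤? a
... | yes _   = refl
... | no  x≰a = ⊥-elim (x≰a x≤a)

reflect-> : ∀ n a x → ¬ x ≤ a → reflect n a x ≡ a + n ∸ x
reflect-> n a x x≰a with x ≤? a
... | yes x≤a = ⊥-elim (x≰a x≤a)
... | no  _   = refl

reflect-below : ∀ n x p → reflect n (x + p) x ≡ p
reflect-below n x p = trans (reflect-≤ n (x + p) x (m≤m+n x p)) (m+n∸m≡n x p)

reflect-above : ∀ n a s → reflect n a (a + suc s) ≡ n ∸ suc s
reflect-above n a s = trans (reflect-> n a (a + suc s) (m+1+n≰m a)) ([m+n]∸[m+o]≡n∸o a n (suc s))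

reflect<n : ∀ {n a x} → a < n → x < n → reflect n a x < n
reflect<n {n} {a} {x} a<n x<n with compare≤ x a
... | below p refl = subst (_< n) (sym (reflect-below n x p)) (≤-<-trans (m≤n+m p x) a<n)
... | above s refl = subst (_< n) (sym (reflect-above n a s)) (n∸1+m<n (≤-<-trans z≤n a<n))
  where
  n∸1+m<n : ∀ {m n} → 0 < n → n ∸ suc m < n
  n∸1+m<n {m} {suc n} _ = s≤s (m∸n≤m n m)

reflect-involutive : ∀ {n a x} → a < n → x < n → reflect n a (reflect n a x) ≡ x
reflect-involutive {n} {a} {x} a<n x<n with compare≤ x a
... | below p refl = begin
  reflect n (x + p) (reflect n (x + p) x) ≡⟨ cong (reflect n (x + p)) (reflect-below n x p) ⟩
  reflect n (x + p) p                     ≡⟨ reflect-≤ n (x + p) p (m≤n+m p x) ⟩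
  x + p ∸ p                               ≡⟨ m+n∸n≡m x p ⟩
  x                                       ∎
  where open ≡-Reasoning
... | above s refl with m≤n⇒∃[o]m+o≡n x<n
...   | o , refl = begin
  reflect n a (reflect n a (a + suc s))   ≡⟨ cong (reflect n a) (reflect-above n a s) ⟩
  reflect n a (n ∸ suc s)                 ≡⟨ cong (reflect n a) (m≡n+o⇒m∸n≡o (suc s) n≡s+o) ⟩
  reflect n a (a + suc o)                 ≡⟨ reflect-above n a o ⟩
  n ∸ suc o                               ≡⟨ m≡n+o⇒m∸n≡o (suc o) n≡o+s ⟩
  a + suc s                               ∎
  where
  open ≡-Reasoning
  n≡s+o : suc (a + suc s) + o ≡ suc s + (a + suc o)
  n≡s+o = solve (a ∷ s ∷ o ∷ [])
  n≡o+s : suc (a + suc s) + o ≡ suc o + (a + suc s)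
  n≡o+s = solve (a ∷ s ∷ o ∷ [])

∣∸-∸∣ : ∀ {A x y} → x ≤ A → y ≤ A → ∣ A ∸ x - A ∸ y ∣ ≡ ∣ x - y ∣
∣∸-∸∣ {A} {x} {y} x≤A y≤A = begin
  ∣ A ∸ x - A ∸ y ∣                        ≡⟨ ∣m+n-m+o∣≡∣n-o∣ (x + y) (A ∸ x) (A ∸ y) ⟨
  ∣ x + y + (A ∸ x) - x + y + (A ∸ y) ∣    ≡⟨ cong ∣ x + y + (A ∸ x) -_∣ (cong (_+ (A ∸ y)) (+-comm x y)) ⟩
  ∣ x + y + (A ∸ x) - y + x + (A ∸ y) ∣    ≡⟨ cong₂ ∣_-_∣ (cancel x≤A) (cancel y≤A) ⟩
  ∣ A + y - A + x ∣                        ≡⟨ ∣m+n-m+o∣≡∣n-o∣ A y x ⟩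
  ∣ y - x ∣                                ≡⟨ ∣-∣-comm y x ⟩
  ∣ x - y ∣                                ∎
  where
  open ≡-Reasoning
  cancel : ∀ {u v} → u ≤ A → u + v + (A ∸ u) ≡ A + v
  cancel {u} {v} u≤A = trans (xy∙z≈xz∙y u v (A ∸ u)) (cong (_+ v) (m+[n∸m]≡n u≤A))

cycDist-reflect-across : ∀ {n a x y} → x ≤ a → ¬ y ≤ a → y < n →
  cycDist n (reflect n a x) (reflect n a y) ≡ cycDist n x y
cycDist-reflect-across {n} {a} {x} {y} x≤a y≰a y<n with compare≤ x a | compare≤ y a
... | above s x≡ | _         = ⊥-elim (m+1+n≰m a (subst (_≤ a) x≡ x≤a))
... | _         | below p a≡ = ⊥-elim (y≰a (subst (y ≤_) (sym a≡) (m≤m+n y p)))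
... | below p refl | above s refl with m≤n⇒∃[o]m+o≡n y<n
...   | o , refl = begin
  cycDist n (reflect n (x + p) x) (reflect n (x + p) (x + p + suc s))
      ≡⟨ cong₂ (cycDist n) (reflect-below n x p) (reflect-above n (x + p) s) ⟩
  cycDist n p (n ∸ suc s)             ≡⟨ cong (cycDist n p) (m≡n+o⇒m∸n≡o (suc s) n≡s+[p+[x+o]]) ⟩
  cycDist n p (p + (x + suc o))       ≡⟨ cong (cycNorm n) (∣m-m+n∣≡n p _) ⟩
  cycNorm n (x + suc o)               ≡⟨ cong (cycNorm n) (m≡n+o⇒m∸n≡o (p + suc s) n≡[p+s]+[x+o]) ⟨
  cycNorm n (n ∸ (p + suc s))         ≡⟨ cycNorm-flip (≤-trans (m≤m+n _ _) (≤-reflexive (sym n≡[p+s]+[x+o]))) ⟩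
  cycNorm n (p + suc s)               ≡⟨ cong (cycNorm n) (∣m-m+n∣≡n x (p + suc s)) ⟨
  cycNorm n ∣ x - x + (p + suc s) ∣   ≡⟨ cong (λ z → cycNorm n ∣ x - z ∣) (+-assoc x p (suc s)) ⟨
  cycDist n x (x + p + suc s)         ∎
  where
  open ≡-Reasoning
  n≡s+[p+[x+o]] : suc (x + p + suc s) + o ≡ suc s + (p + (x + suc o))
  n≡s+[p+[x+o]] = solve (x ∷ p ∷ s ∷ o ∷ [])
  n≡[p+s]+[x+o] : suc (x + p + suc s) + o ≡ p + suc s + (x + suc o)
  n≡[p+s]+[x+o] = solve (x ∷ p ∷ s ∷ o ∷ [])

cycDist-reflect : ∀ {n a x y} → a < n → x < n → y < n →
  cycDist n (reflect n a x) (reflect n a y) ≡ cycDist n x y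
cycDist-reflect {n} {a} {x} {y} a<n x<n y<n = by-cases (x ≤? a) (y ≤? a)
  where
  by-cases : Dec (x ≤ a) → Dec (y ≤ a) → cycDist n (reflect n a x) (reflect n a y) ≡ cycDist n x y
  by-cases (yes x≤a) (yes y≤a) rewrite reflect-≤ n a x x≤a | reflect-≤ n a y y≤a =
    cong (cycNorm n) (∣∸-∸∣ x≤a y≤a)
  by-cases (no  x≰a) (no  y≰a) rewrite reflect-> n a x x≰a | reflect-> n a y y≰a =
    cong (cycNorm n) (∣∸-∸∣ (≤-trans (<⇒≤ x<n) (m≤n+m n a)) (≤-trans (<⇒≤ y<n) (m≤n+m n a)))
  by-cases (yes x≤a) (no  y≰a) = cycDist-reflect-across x≤a y≰a y<n
  by-cases (no  x≰a) (yes y≤a) = begin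
    cycDist n (reflect n a x) (reflect n a y)  ≡⟨ cycDist-sym n (reflect n a x) (reflect n a y) ⟩
    cycDist n (reflect n a y) (reflect n a x)  ≡⟨ cycDist-reflect-across y≤a x≰a x<n ⟩
    cycDist n y x                              ≡⟨ cycDist-sym n y x ⟩
    cycDist n x y                              ∎
    where open ≡-Reasoning

reflect-edge : ∀ {n a r} → suc r < n → CycEdge n (reflect n a (suc r)) (reflect n a r)
reflect-edge {n} {a} {r} 1+r<n with compare≤ r a
... | below zero refl = inj₂ (wrap , reflect-below n r 0)
  where
  1+r≡r+0+1 : suc r ≡ r + 0 + 1
  1+r≡r+0+1 = solve (r ∷ [])
  wrap : reflect n (r + 0) (suc r) ≡ n ∸ 1
  wrap = trans (cong (reflect n (r + 0)) 1+r≡r+0+1) (reflect-above n (r + 0) 0)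
... | below (suc p) refl =
  inj₁ (trans (cong suc (trans (cong (λ b → reflect n b (suc r)) (+-suc r p)) (reflect-below n (suc r) p)))
              (sym (reflect-below n r (suc p))))
... | above s refl = inj₁ (begin
  suc (reflect n a (suc (a + suc s)))   ≡⟨ cong (λ x → suc (reflect n a x)) (sym (+-suc a (suc s))) ⟩
  suc (reflect n a (a + suc (suc s)))   ≡⟨ cong suc (reflect-above n a (suc s)) ⟩
  suc (n ∸ suc (suc s))                 ≡⟨ +-∸-assoc 1 (≤-trans (s≤s (m≤n+m (suc s) a)) (<⇒≤ 1+r<n)) ⟨
  n ∸ suc s                             ≡⟨ reflect-above n a s ⟨
  reflect n a (a + suc s)               ∎)
  where open ≡-Reasoning

<-⊓+⊓ : ∀ {t a b c d} → t < a → t < d → t < b + c → t < a ⊓ b + c ⊓ d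
<-⊓+⊓ {t} {a} {b} {c} {d} t<a t<d t<b+c with ⊓-sel a b | ⊓-sel c d
... | inj₁ a⊓b≡a | _           rewrite a⊓b≡a               = <-≤-trans t<a (m≤m+n a _)
... | inj₂ a⊓b≡b | inj₁ c⊓d≡c rewrite a⊓b≡b | c⊓d≡c      = t<b+c
... | inj₂ a⊓b≡b | inj₂ c⊓d≡d rewrite a⊓b≡b | c⊓d≡d      = <-≤-trans t<d (m≤n+m d b)

cycNorm-detour : ∀ {n e b} → 0 < b → e + b < n → e + e < n → e < cycNorm n (e + b) + cycNorm n b
cycNorm-detour {n} {e} {b} 0<b e+b<n e+e<n = <-⊓+⊓ (m<m+n e 0<b) (m+n≤o⇒m≤o∸n (suc e) e+b<n) (begin-strict
  e                          <⟨ m+n≤o⇒m≤o∸n (suc e) e+e<n ⟩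
  n ∸ e                      ≡⟨ m∸n+n≡m (m+n≤o⇒m≤o∸n b (≤-trans (≤-reflexive (+-comm b e)) (<⇒≤ e+b<n))) ⟨
  n ∸ e ∸ b + b              ≡⟨ cong (_+ b) (∸-+-assoc n e b) ⟩
  n ∸ (e + b) + b            ∎)
  where open ≤-Reasoning

cycDist-detour-ordered : ∀ {n h u v m} → u ≤ v → v < h → h ≤ m → m < n → h + h ≤ suc n →
  cycDist n u v < cycDist n u m + cycDist n m v
cycDist-detour-ordered {n} {h} {u} u≤v v<h h≤m m<n 2h≤1+n
  with m≤n⇒∃[o]m+o≡n u≤v | m≤n⇒∃[o]m+o≡n (<-≤-trans v<h h≤m)
... | e , refl | b , refl = begin-strict
  cycDist n u (u + e)                          ≡⟨ cong (cycNorm n) (∣m-m+n∣≡n u e) ⟩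
  cycNorm n e                                  ≤⟨ m⊓n≤m e _ ⟩
  e                                            <⟨ cycNorm-detour z<s e+b<n e+e<n ⟩
  cycNorm n (e + suc b) + cycNorm n (suc b)    ≡⟨ cong₂ (λ p q → cycNorm n p + cycNorm n q) ∣u-m∣ ∣m-v∣ ⟨
  cycDist n u (suc (u + e) + b) + cycDist n (suc (u + e) + b) (u + e)  ∎
  where
  open ≤-Reasoning
  m≡u+[e+b] : suc (u + e) + b ≡ u + (e + suc b)
  m≡u+[e+b] = solve (u ∷ e ∷ b ∷ [])
  m≡u+e+b : suc (u + e) + b ≡ u + e + suc b
  m≡u+e+b = solve (u ∷ e ∷ b ∷ [])
  ∣u-m∣ : ∣ u - suc (u + e) + b ∣ ≡ e + suc b
  ∣u-m∣ = trans (cong ∣ u -_∣ m≡u+[e+b]) (∣m-m+n∣≡n u _)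
  ∣m-v∣ : ∣ suc (u + e) + b - u + e ∣ ≡ suc b
  ∣m-v∣ = trans (∣-∣-comm _ (u + e)) (trans (cong ∣ u + e -_∣ m≡u+e+b) (∣m-m+n∣≡n (u + e) (suc b)))
  e+b<n : e + suc b < n
  e+b<n = <-≤-trans (s≤s (≤-trans (m≤n+m _ u) (≤-reflexive (sym m≡u+[e+b])))) m<n
  e+e<n : e + e < n
  e+e<n = ≤-pred (begin
    suc (suc (e + e))    ≡⟨ cong suc (+-suc e e) ⟨
    suc e + suc e        ≤⟨ +-mono-≤ e<h e<h ⟩
    h + h                ≤⟨ 2h≤1+n ⟩
    suc n                ∎)
    where
    e<h : e < h
    e<h = ≤-<-trans (m≤n+m e u) v<h

cycDist-detour : ∀ {n h x y m} → x < h → y < h → h ≤ m → m < n → h + h ≤ suc n →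
  cycDist n x y < cycDist n x m + cycDist n m y
cycDist-detour {n} {h} {x} {y} {m} x<h y<h h≤m m<n 2h≤1+n with ≤-total x y
... | inj₁ x≤y = cycDist-detour-ordered x≤y y<h h≤m m<n 2h≤1+n
... | inj₂ y≤x = begin-strict
  cycDist n x y                    ≡⟨ cycDist-sym n x y ⟩
  cycDist n y x                    <⟨ cycDist-detour-ordered y≤x x<h h≤m m<n 2h≤1+n ⟩
  cycDist n y m + cycDist n m x    ≡⟨ cong₂ _+_ (cycDist-sym n y m) (cycDist-sym n m x) ⟩
  cycDist n m y + cycDist n x m    ≡⟨ +-comm (cycDist n m y) _ ⟩
  cycDist n x m + cycDist n m y    ∎
  where open ≤-Reasoning

cycDist-via-0 : ∀ {n j e} → j + e ≤ n → n ≤ e + e → cycDist n j 0 + cycDist n 0 (j + e) ≤ cycDist n j (j + e)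
cycDist-via-0 {n} {j} {e} j+e≤n n≤e+e = begin
  cycDist n j 0 + cycDist n 0 (j + e)    ≤⟨ +-mono-≤ (m⊓n≤m ∣ j - 0 ∣ _) (m⊓n≤n (j + e) _) ⟩
  ∣ j - 0 ∣ + (n ∸ (j + e))              ≡⟨ cong₂ _+_ (∣-∣-identityʳ j) (cong (n ∸_) (+-comm j e)) ⟩
  j + (n ∸ (e + j))                      ≡⟨ cong (j +_) (∸-+-assoc n e j) ⟨
  j + (n ∸ e ∸ j)                        ≡⟨ m+[n∸m]≡n (m+n≤o⇒m≤o∸n j j+e≤n) ⟩
  n ∸ e                                  ≡⟨ m≥n⇒m⊓n≡n (m≤n+o⇒m∸n≤o n e n≤e+e) ⟨
  cycNorm n e                            ≡⟨ cong (cycNorm n) (∣m-m+n∣≡n j e) ⟨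
  cycDist n j (j + e)                    ∎
  where open ≤-Reasoning

-- the length of the walk m → m + 1 → ⋯ → n − 1 → 0 → 1 → ⋯ → k
wrapAround-length : ∀ {n m k} → k ≤ m → m < n → n ∸ 1 ∸ m + suc k ≡ n ∸ (m ∸ k)
wrapAround-length {k = k} k≤m m<n with m≤n⇒∃[o]m+o≡n k≤m
... | e , refl with m≤n⇒∃[o]m+o≡n m<n
...   | g , refl = begin
  k + e + g ∸ (k + e) + suc k          ≡⟨ cong (_+ suc k) (m+n∸m≡n (k + e) g) ⟩
  g + suc k                            ≡⟨ m≡n+o⇒m∸n≡o e n≡e+[g+1+k] ⟨
  suc (k + e) + g ∸ e                  ≡⟨ cong (suc (k + e) + g ∸_) (m+n∸m≡n k e) ⟨
  suc (k + e) + g ∸ (k + e ∸ k)        ∎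
  where
  open ≡-Reasoning
  n≡e+[g+1+k] : suc (k + e) + g ≡ e + (g + suc k)
  n≡e+[g+1+k] = solve (k ∷ e ∷ g ∷ [])

⌈n/2⌉+⌈n/2⌉≤1+n : ∀ n → ⌈ n /2⌉ + ⌈ n /2⌉ ≤ suc n
⌈n/2⌉+⌈n/2⌉≤1+n zero          = z≤n
⌈n/2⌉+⌈n/2⌉≤1+n (suc zero)    = ≤-refl
⌈n/2⌉+⌈n/2⌉≤1+n (suc (suc n)) = s≤s (begin
  ⌈ n /2⌉ + suc ⌈ n /2⌉   ≡⟨ +-suc ⌈ n /2⌉ ⌈ n /2⌉ ⟩
  suc (⌈ n /2⌉ + ⌈ n /2⌉) ≤⟨ s≤s (⌈n/2⌉+⌈n/2⌉≤1+n n) ⟩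
  suc (suc n)             ∎)
  where open ≤-Reasoning

n≤⌈n/2⌉+⌈n/2⌉ : ∀ n → n ≤ ⌈ n /2⌉ + ⌈ n /2⌉
n≤⌈n/2⌉+⌈n/2⌉ n = begin
  n                     ≡⟨ ⌊n/2⌋+⌈n/2⌉≡n n ⟨
  ⌊ n /2⌋ + ⌈ n /2⌉     ≤⟨ +-monoˡ-≤ ⌈ n /2⌉ (⌊n/2⌋≤⌈n/2⌉ n) ⟩
  ⌈ n /2⌉ + ⌈ n /2⌉     ∎
  where open ≤-Reasoning

1<n⇒⌈n/2⌉<n : ∀ {n} → 1 < n → ⌈ n /2⌉ < n
1<n⇒⌈n/2⌉<n {suc (suc n)} (s≤s (s≤s z≤n)) = ⌈n/2⌉<n n

⌈n/2⌉≤n∸1 : ∀ {n} → 1 < n → ⌈ n /2⌉ ≤ n ∸ 1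
⌈n/2⌉≤n∸1 {suc (suc n)} 1<n@(s≤s (s≤s z≤n)) = ≤-pred (1<n⇒⌈n/2⌉<n 1<n)

0<⌈n/2⌉ : ∀ {n} → 0 < n → 0 < ⌈ n /2⌉
0<⌈n/2⌉ {suc n} _ = z<s

-- The corona C_n ⊙ K_1

pattern cyc i  = inj₁ i
pattern leaf i = inj₂ i

module Corona (n : ℕ) (1<n : 1 < n) where

  G : Graph
  G = CnCoronaK1 n

  Vertex : Set
  Vertex = Fin n ⊎ Fin n

  ⌜_⌝ : Vertex → Fin (n + n)
  ⌜_⌝ = join n n

  splitAt-⌜⌝ : ∀ s → splitAt n ⌜ s ⌝ ≡ s
  splitAt-⌜⌝ = splitAt-join n n

  adj : ∀ {s t} → CoronaAdj' n s t → Adj G ⌜ s ⌝ ⌜ t ⌝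
  adj {s} {t} = subst₂ (CoronaAdj' n) (sym (splitAt-⌜⌝ s)) (sym (splitAt-⌜⌝ t))

  CoronaAdj-sym : ∀ s t → CoronaAdj' n s t → CoronaAdj' n t s
  CoronaAdj-sym (cyc i)  (cyc j)  (inj₁ i→j , i≢j) = inj₂ i→j , ≢-sym i≢j
  CoronaAdj-sym (cyc i)  (cyc j)  (inj₂ j→i , i≢j) = inj₁ j→i , ≢-sym i≢j
  CoronaAdj-sym (cyc i)  (leaf j) i≡j              = sym i≡j
  CoronaAdj-sym (leaf i) (cyc j)  i≡j              = sym i≡j

  Adj-sym : ∀ {x y} → Adj G x y → Adj G y x
  Adj-sym {x} {y} = CoronaAdj-sym (splitAt n x) (splitAt n y)

  open Walks G

  dC : Fin n → Fin n → ℕ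
  dC i j = cycDist n (toℕ i) (toℕ j)

  D : Vertex → Vertex → ℕ
  D (cyc i)  (cyc j)  = dC i j
  D (cyc i)  (leaf j) = suc (dC i j)
  D (leaf i) (cyc j)  = suc (dC i j)
  D (leaf i) (leaf j) = if does (i Fin.≟ j) then 0 else 2 + dC i j

  dist : Fin (n + n) → Fin (n + n) → ℕ
  dist x y = D (splitAt n x) (splitAt n y)

  dC-refl : ∀ i → dC i i ≡ 0
  dC-refl i = cycDist-refl n (toℕ i)

  D-refl : ∀ s → D s s ≡ 0
  D-refl (cyc i) = dC-refl i
  D-refl (leaf i) with i Fin.≟ i
  ... | yes _  = refl
  ... | no i≢i = ⊥-elim (i≢i refl)

  D-leaf-≢ : ∀ {i j} → i ≢ j → D (leaf i) (leaf j) ≡ 2 + dC i j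
  D-leaf-≢ {i} {j} i≢j with i Fin.≟ j
  ... | yes i≡j = ⊥-elim (i≢j i≡j)
  ... | no  _   = refl

  D-cyc≤1+D-leaf : ∀ i t → D (cyc i) t ≤ suc (D (leaf i) t)
  D-cyc≤1+D-leaf i (cyc k) = ≤-trans (n≤1+n _) (n≤1+n _)
  D-cyc≤1+D-leaf i (leaf k) with i Fin.≟ k
  ... | yes refl = ≤-reflexive (cong suc (dC-refl i))
  ... | no  _    = s≤s (≤-trans (n≤1+n _) (n≤1+n _))

  D-leaf≤1+D-cyc : ∀ i t → D (leaf i) t ≤ suc (D (cyc i) t)
  D-leaf≤1+D-cyc i (cyc k) = ≤-refl
  D-leaf≤1+D-cyc i (leaf k) with i Fin.≟ k
  ... | yes _ = z≤n
  ... | no  _ = ≤-refl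

  D-step : ∀ s w t → CoronaAdj' n s w → D s t ≤ suc (D w t)
  D-step (cyc i)  (cyc j)  (cyc k)  (inj₁ i→j , _) = proj₁ (cycDist-edge i→j (toℕ<n k))
  D-step (cyc i)  (cyc j)  (cyc k)  (inj₂ j→i , _) = proj₂ (cycDist-edge j→i (toℕ<n k))
  D-step (cyc i)  (cyc j)  (leaf k) (inj₁ i→j , _) = s≤s (proj₁ (cycDist-edge i→j (toℕ<n k)))
  D-step (cyc i)  (cyc j)  (leaf k) (inj₂ j→i , _) = s≤s (proj₂ (cycDist-edge j→i (toℕ<n k)))
  D-step (cyc i)  (leaf .i) t refl = D-cyc≤1+D-leaf i t
  D-step (leaf i) (cyc .i)  t refl = D-leaf≤1+D-cyc i t

  dist≤len : ∀ {x y} (p : Walk G x y) → dist x y ≤ len G p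
  dist≤len {x} (nil _)                 = ≤-reflexive (D-refl (splitAt n x))
  dist≤len {x} {y} (cons {w = w} a p) = ≤-trans (D-step (splitAt n x) (splitAt n w) (splitAt n y) a) (s≤s (dist≤len p))

  WalkOfLength : Vertex → Vertex → ℕ → Set
  WalkOfLength s t k = Σ (Walk G ⌜ s ⌝ ⌜ t ⌝) λ p → len G p ≡ k

  reversed : ∀ {s t k} → WalkOfLength s t k → WalkOfLength t s k
  reversed (p , len≡k) = reverse Adj-sym p , trans (length-reverse Adj-sym p) len≡k

  forward : ∀ k {i j : Fin n} → toℕ j ≡ toℕ i + k → WalkOfLength (cyc i) (cyc j) k
  forward zero {i} {j} j≡i+0 = subst (λ j → WalkOfLength (cyc i) (cyc j) 0) i≡j (nil _ , refl)
    where
    i≡j : i ≡ j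
    i≡j = toℕ-injective (sym (trans j≡i+0 (+-identityʳ (toℕ i))))
  forward (suc k) {i} {j} j≡i+1+k = cons (adj (inj₁ (inj₁ (sym i+1≡)) , i≢i+1)) (proj₁ rest) , cong suc (proj₂ rest)
    where
    i+1<n : suc (toℕ i) < n
    i+1<n = ≤-<-trans (≤-trans (s≤s (m≤m+n (toℕ i) k)) (≤-reflexive (sym (trans j≡i+1+k (+-suc (toℕ i) k))))) (toℕ<n j)
    i+1≡ : toℕ (fromℕ< i+1<n) ≡ suc (toℕ i)
    i+1≡ = toℕ-fromℕ< i+1<n
    i≢i+1 : i ≢ fromℕ< i+1<n
    i≢i+1 i≡i+1 = 1+n≢n (sym (trans (cong toℕ i≡i+1) i+1≡))
    rest : WalkOfLength (cyc (fromℕ< i+1<n)) (cyc j) k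
    rest = forward k (trans j≡i+1+k (trans (+-suc (toℕ i) k) (cong (_+ k) (sym i+1≡))))

  0<n : 0 < n
  0<n = <-trans z<s 1<n

  1+n∸1≡n : suc (n ∸ 1) ≡ n
  1+n∸1≡n = trans (+-comm 1 (n ∸ 1)) (m∸n+n≡m 0<n)

  n∸1<n : n ∸ 1 < n
  n∸1<n = ≤-reflexive 1+n∸1≡n

  instance
    n-nonZero : NonZero n
    n-nonZero = >-nonZero 0<n

  h : ℕ
  h = ⌈ n /2⌉

  h<n : h < n
  h<n = 1<n⇒⌈n/2⌉<n 1<n

  h≤n∸1 : h ≤ n ∸ 1
  h≤n∸1 = ⌈n/2⌉≤n∸1 1<n

  wrapAround : ∀ i j → toℕ j ≤ toℕ i → WalkOfLength (cyc i) (cyc j) (n ∸ (toℕ i ∸ toℕ j))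
  wrapAround i j j≤i =
    proj₁ to-last ++ʷ cons (adj (inj₁ (inj₂ (toℕ-fromℕ< n∸1<n , toℕ-fromℕ< 0<n)) , last≢0)) (proj₁ from-0) ,
    (begin
      len G (proj₁ to-last ++ʷ _)                     ≡⟨ length-++ʷ (proj₁ to-last) _ ⟩
      len G (proj₁ to-last) + suc (len G (proj₁ from-0)) ≡⟨ cong₂ (λ a b → a + suc b) (proj₂ to-last) (proj₂ from-0) ⟩
      n ∸ 1 ∸ toℕ i + suc (toℕ j)                    ≡⟨ wrapAround-length j≤i (toℕ<n i) ⟩
      n ∸ (toℕ i ∸ toℕ j)                            ∎)
    where
    open ≡-Reasoning
    i≤n∸1 : toℕ i ≤ n ∸ 1
    i≤n∸1 = ≤-trans (<⇒≤pred (toℕ<n i)) (≤-reflexive (pred[m∸n]≡m∸[1+n] n 0))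
    to-last : WalkOfLength (cyc i) (cyc (fromℕ< n∸1<n)) (n ∸ 1 ∸ toℕ i)
    to-last = forward _ (trans (toℕ-fromℕ< n∸1<n) (sym (m+[n∸m]≡n i≤n∸1)))
    from-0 : WalkOfLength (cyc (fromℕ< 0<n)) (cyc j) (toℕ j)
    from-0 = forward _ (cong (_+ toℕ j) (sym (toℕ-fromℕ< 0<n)))
    last≢0 : fromℕ< n∸1<n ≢ fromℕ< 0<n
    last≢0 e = m>n⇒m∸n≢0 1<n (trans (sym (toℕ-fromℕ< n∸1<n)) (trans (cong toℕ e) (toℕ-fromℕ< 0<n)))

  walk-∣-∣ : ∀ i j → WalkOfLength (cyc i) (cyc j) ∣ toℕ i - toℕ j ∣
  walk-∣-∣ i j with ≤-total (toℕ i) (toℕ j)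
  ... | inj₁ i≤j = subst (WalkOfLength (cyc i) (cyc j)) (sym (m≤n⇒∣m-n∣≡n∸m i≤j))
                         (forward _ (sym (m+[n∸m]≡n i≤j)))
  ... | inj₂ j≤i = subst (WalkOfLength (cyc i) (cyc j)) (sym (m≤n⇒∣n-m∣≡n∸m j≤i))
                         (reversed {cyc j} {cyc i} (forward _ (sym (m+[n∸m]≡n j≤i))))

  walk-n∸∣-∣ : ∀ i j → WalkOfLength (cyc i) (cyc j) (n ∸ ∣ toℕ i - toℕ j ∣)
  walk-n∸∣-∣ i j with ≤-total (toℕ i) (toℕ j)
  ... | inj₁ i≤j = subst (λ k → WalkOfLength (cyc i) (cyc j) (n ∸ k)) (sym (m≤n⇒∣m-n∣≡n∸m i≤j))
                         (reversed {cyc j} {cyc i} (wrapAround j i i≤j))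
  ... | inj₂ j≤i = subst (λ k → WalkOfLength (cyc i) (cyc j) (n ∸ k)) (sym (m≤n⇒∣n-m∣≡n∸m j≤i))
                         (wrapAround i j j≤i)

  ShortWalk : Vertex → Vertex → Set
  ShortWalk s t = Σ (Walk G ⌜ s ⌝ ⌜ t ⌝) λ p → len G p ≤ D s t

  cycleWalk : ∀ i j → ShortWalk (cyc i) (cyc j)
  cycleWalk i j with ⊓-sel ∣ toℕ i - toℕ j ∣ (n ∸ ∣ toℕ i - toℕ j ∣) | walk-∣-∣ i j | walk-n∸∣-∣ i j
  ... | inj₁ dC≡∣-∣   | p , len≡ | _        = p , ≤-reflexive (trans len≡ (sym dC≡∣-∣))
  ... | inj₂ dC≡n∸∣-∣ | _        | q , len≡ = q , ≤-reflexive (trans len≡ (sym dC≡n∸∣-∣))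

  cyc→leaf : ∀ i → Adj G ⌜ cyc i ⌝ ⌜ leaf i ⌝
  cyc→leaf i = adj {cyc i} {leaf i} refl

  leaf→cyc : ∀ i → Adj G ⌜ leaf i ⌝ ⌜ cyc i ⌝
  leaf→cyc i = adj {leaf i} {cyc i} refl

  shortWalk : ∀ s t → ShortWalk s t
  shortWalk (cyc i)  (cyc j)  = cycleWalk i j
  shortWalk (cyc i)  (leaf j) with cycleWalk i j
  ... | p , p≤ = p ++ʷ cons (cyc→leaf j) (nil _) , ≤-trans (≤-reflexive (trans (length-++ʷ p _) (+-comm _ 1))) (s≤s p≤)
  shortWalk (leaf i) (cyc j)  with cycleWalk i j
  ... | p , p≤ = cons (leaf→cyc i) p , s≤s p≤
  shortWalk (leaf i) (leaf j) with i Fin.≟ j | cycleWalk i j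
  ... | yes refl | _      = nil _ , z≤n
  ... | no  _    | p , p≤ = cons (leaf→cyc i) (p ++ʷ cons (cyc→leaf j) (nil _)) ,
                            s≤s (≤-trans (≤-reflexive (trans (length-++ʷ p _) (+-comm _ 1))) (s≤s p≤))

  dist-attained : ∀ x y → Σ (Walk G x y) λ p → len G p ≤ dist x y
  dist-attained x y = subst₂ (λ a b → Σ (Walk G a b) λ p → len G p ≤ dist x y)
    (join-splitAt n n x) (join-splitAt n n y) (shortWalk (splitAt n x) (splitAt n y))

  open Distance G dist dist≤len dist-attained public

  pos : Vertex → Fin n
  pos (cyc i)  = i
  pos (leaf i) = i

  height : Vertex → ℕ
  height (cyc _)  = 0
  height (leaf _) = 1

  D≤ : ∀ s t → D s t ≤ height s + dC (pos s) (pos t) + height t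
  D≤ (cyc i)  (cyc j)  = ≤-reflexive (sym (+-identityʳ _))
  D≤ (cyc i)  (leaf j) = ≤-reflexive (+-comm 1 (dC i j))
  D≤ (leaf i) (cyc j)  = ≤-reflexive (sym (+-identityʳ _))
  D≤ (leaf i) (leaf j) with i Fin.≟ j
  ... | yes _ = z≤n
  ... | no  _ = ≤-reflexive (cong suc (+-comm 1 (dC i j)))

  D-≢ : ∀ {s t} → s ≢ t → D s t ≡ height s + dC (pos s) (pos t) + height t
  D-≢ {cyc i}  {cyc j}  _   = sym (+-identityʳ _)
  D-≢ {cyc i}  {leaf j} _   = +-comm 1 (dC i j)
  D-≢ {leaf i} {cyc j}  _   = sym (+-identityʳ _)
  D-≢ {leaf i} {leaf j} s≢t = trans (D-leaf-≢ (λ i≡j → s≢t (cong leaf i≡j))) (cong suc (+-comm 1 (dC i j)))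

  dist-⌜⌝ : ∀ s t → dist ⌜ s ⌝ ⌜ t ⌝ ≡ D s t
  dist-⌜⌝ s t = cong₂ D (splitAt-⌜⌝ s) (splitAt-⌜⌝ t)

  dC-triangle : ∀ i j k → dC i k ≤ dC i j + dC j k
  dC-triangle i j k =
    subst₂ _≤_ (dist-⌜⌝ (cyc i) (cyc k)) (cong₂ _+_ (dist-⌜⌝ (cyc i) (cyc j)) (dist-⌜⌝ (cyc j) (cyc k)))
               (d-triangle ⌜ cyc i ⌝ ⌜ cyc j ⌝ ⌜ cyc k ⌝)

  leaf-not-between : ∀ {s r i} → s ≢ leaf i → leaf i ≢ r → D s r < D s (leaf i) + D (leaf i) r
  leaf-not-between {s} {r} {i} s≢ ≢r = begin-strict
    D s r                                ≤⟨ D≤ s r ⟩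
    hs + dC (pos s) (pos r) + hr         ≤⟨ +-monoˡ-≤ hr (+-monoʳ-≤ hs (dC-triangle (pos s) i (pos r))) ⟩
    hs + (dsi + dir) + hr                <⟨ m<n+m _ {2} z<s ⟩
    2 + (hs + (dsi + dir) + hr)          ≡⟨ rearrange hs dsi dir hr ⟩
    hs + dsi + 1 + (1 + dir + hr)        ≡⟨ cong₂ _+_ (D-≢ s≢) (D-≢ ≢r) ⟨
    D s (leaf i) + D (leaf i) r          ∎
    where
    open ≤-Reasoning
    hs = height s
    hr = height r
    dsi = dC (pos s) i
    dir = dC i (pos r)
    rearrange : ∀ a b c d → 2 + (a + (b + c) + d) ≡ a + b + 1 + (1 + c + d)
    rearrange = solve-∀

  cyc-between : ∀ {s t} i → s ≢ t → dC (pos s) i + dC i (pos t) ≤ dC (pos s) (pos t) →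
    D s (cyc i) + D (cyc i) t ≤ D s t
  cyc-between {s} {t} i s≢t detour≤ = begin
    D s (cyc i) + D (cyc i) t            ≤⟨ +-mono-≤ (D≤ s (cyc i)) (D≤ (cyc i) t) ⟩
    hs + dsi + 0 + (0 + dit + ht)        ≡⟨ rearrange hs dsi dit ht ⟩
    hs + (dsi + dit) + ht                ≤⟨ +-monoˡ-≤ ht (+-monoʳ-≤ hs detour≤) ⟩
    hs + dC (pos s) (pos t) + ht         ≡⟨ D-≢ s≢t ⟨
    D s t                                ∎
    where
    open ≤-Reasoning
    hs = height s
    ht = height t
    dsi = dC (pos s) i
    dit = dC i (pos t)
    rearrange : ∀ a b c d → a + b + 0 + (0 + c + d) ≡ a + (b + c) + d
    rearrange = solve-∀

  ⌜splitAt⌝ : ∀ x → ⌜ splitAt n x ⌝ ≡ x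
  ⌜splitAt⌝ = join-splitAt n n

  ⌜⌝-injective : ∀ {s t} → ⌜ s ⌝ ≡ ⌜ t ⌝ → s ≡ t
  ⌜⌝-injective {s} {t} eq = trans (sym (splitAt-⌜⌝ s)) (trans (cong (splitAt n) eq) (splitAt-⌜⌝ t))

  NoCycBetween : Subset (n + n) → Set
  NoCycBetween S = ∀ {s i t} → ⌜ s ⌝ ∈ S → ⌜ cyc i ⌝ ∈ S → ⌜ t ⌝ ∈ S →
                   s ≢ cyc i → cyc i ≢ t → s ≢ t → D s t ≢ D s (cyc i) + D (cyc i) t

  generalPosition-if-noCycBetween : (S : Subset (n + n)) → NoCycBetween S → IsGeneralPosition G S
  generalPosition-if-noCycBetween S noCycBetween = generalPosition-if-noneBetween S noneBetween
    where
    inS : ∀ {x} → x ∈ S → ⌜ splitAt n x ⌝ ∈ S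
    inS {x} = subst (_∈ S) (sym (⌜splitAt⌝ x))
    split≢ : ∀ {x y} → x ≢ y → splitAt n x ≢ splitAt n y
    split≢ {x} {y} x≢y eq = x≢y (trans (sym (⌜splitAt⌝ x)) (trans (cong ⌜_⌝ eq) (⌜splitAt⌝ y)))
    middle : ∀ {s r} t → ⌜ s ⌝ ∈ S → ⌜ t ⌝ ∈ S → ⌜ r ⌝ ∈ S → s ≢ t → t ≢ r → s ≢ r →
      D s r ≢ D s t + D t r
    middle (cyc i)  s∈S t∈S r∈S s≢t t≢r s≢r = noCycBetween s∈S t∈S r∈S s≢t t≢r s≢r
    middle (leaf i) _   _   _   s≢t t≢r _   = <⇒≢ (leaf-not-between s≢t t≢r)
    noneBetween : ∀ {x y z} → x ∈ S → y ∈ S → z ∈ S → x ≢ y → y ≢ z → x ≢ z → ¬ Between x y z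
    noneBetween {y = y} x∈S y∈S z∈S x≢y y≢z x≢z =
      middle (splitAt n y) (inS x∈S) (inS y∈S) (inS z∈S) (split≢ x≢y) (split≢ y≢z) (split≢ x≢z)

  ¬generalPosition-if-D-between : (S : Subset (n + n)) → ∀ {s t r} → ⌜ s ⌝ ∈ S → ⌜ t ⌝ ∈ S → ⌜ r ⌝ ∈ S →
    s ≢ t → t ≢ r → s ≢ r → D s t + D t r ≤ D s r → ¬ IsGeneralPosition G S
  ¬generalPosition-if-D-between S {s} {t} {r} s∈S t∈S r∈S s≢t t≢r s≢r between =
    ¬generalPosition-if-between S s∈S t∈S r∈S
      (s≢t ∘ ⌜⌝-injective) (t≢r ∘ ⌜⌝-injective) (s≢r ∘ ⌜⌝-injective)
      (subst₂ _≤_ (sym (cong₂ _+_ (dist-⌜⌝ s t) (dist-⌜⌝ t r))) (sym (dist-⌜⌝ s r)) between)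

  cyc-between-leaves : ∀ {i j k} → j ≢ k → D (leaf j) (leaf k) ≡ D (leaf j) (cyc i) + D (cyc i) (leaf k) →
    dC j k ≡ dC j i + dC i k
  cyc-between-leaves {i} {j} {k} j≢k between = suc-injective (suc-injective (begin
    2 + dC j k                        ≡⟨ D-leaf-≢ j≢k ⟨
    D (leaf j) (leaf k)               ≡⟨ between ⟩
    suc (dC j i) + suc (dC i k)       ≡⟨ cong suc (+-suc (dC j i) (dC i k)) ⟩
    2 + (dC j i + dC i k)             ∎))
    where open ≡-Reasoning

  ⟦_⟧ : (Vertex → Bool) → Subset (n + n)
  ⟦ P ⟧ = tabulate (P ∘ splitAt n)

  lookup-⟦⟧ : ∀ P s → lookup ⟦ P ⟧ ⌜ s ⌝ ≡ P s
  lookup-⟦⟧ P s = trans (lookup∘tabulate (P ∘ splitAt n) ⌜ s ⌝) (cong P (splitAt-⌜⌝ s))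

  ∈⟦⟧⁺ : ∀ {P s} → P s ≡ true → ⌜ s ⌝ ∈ ⟦ P ⟧
  ∈⟦⟧⁺ {P} {s} Ps = lookup⇒[]= ⌜ s ⌝ ⟦ P ⟧ (trans (lookup-⟦⟧ P s) Ps)

  ∈⟦⟧⁻ : ∀ {P s} → ⌜ s ⌝ ∈ ⟦ P ⟧ → P s ≡ true
  ∈⟦⟧⁻ {P} {s} s∈P = trans (sym (lookup-⟦⟧ P s)) ([]=⇒lookup s∈P)

  _≟ᵛ_ : (s t : Vertex) → Dec (s ≡ t)
  _≟ᵛ_ = ≡-dec Fin._≟_ Fin._≟_

  ⟦⟧-moved : ∀ {P P′ : Vertex → Bool} {s t} → P′ s ≡ false → P′ t ≡ true →
    (∀ q → q ≢ s → q ≢ t → P′ q ≡ P q) → ⟦ P′ ⟧ ≡ (⟦ P ⟧ [ ⌜ s ⌝ ]≔ outside) [ ⌜ t ⌝ ]≔ inside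
  ⟦⟧-moved {P} {P′} {s} {t} P′s P′t P′≡P =
    ≗⇒≡ λ x → subst (λ y → lookup ⟦ P′ ⟧ y ≡ lookup S′ y) (⌜splitAt⌝ x) (agree (splitAt n x))
    where
    S₁ = ⟦ P ⟧ [ ⌜ s ⌝ ]≔ outside
    S′ = S₁ [ ⌜ t ⌝ ]≔ inside
    ≗⇒≡ : ∀ {m} {u v : Subset m} → (∀ x → lookup u x ≡ lookup v x) → u ≡ v
    ≗⇒≡ {u = u} {v} u≗v = trans (sym (tabulate∘lookup u)) (trans (tabulate-cong u≗v) (tabulate∘lookup v))
    agree : ∀ q → lookup ⟦ P′ ⟧ ⌜ q ⌝ ≡ lookup S′ ⌜ q ⌝
    agree q with q ≟ᵛ t | q ≟ᵛ s
    ... | yes refl | _        = trans (lookup-⟦⟧ P′ t) (trans P′t (sym (lookup∘update ⌜ t ⌝ S₁ inside)))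
    ... | no  q≢t  | yes refl = begin
      lookup ⟦ P′ ⟧ ⌜ s ⌝    ≡⟨ trans (lookup-⟦⟧ P′ s) P′s ⟩
      outside               ≡⟨ lookup∘update ⌜ s ⌝ ⟦ P ⟧ outside ⟨
      lookup S₁ ⌜ s ⌝        ≡⟨ lookup∘update′ (q≢t ∘ ⌜⌝-injective) S₁ inside ⟨
      lookup S′ ⌜ s ⌝        ∎
      where open ≡-Reasoning
    ... | no  q≢t  | no q≢s   = begin
      lookup ⟦ P′ ⟧ ⌜ q ⌝    ≡⟨ lookup-⟦⟧ P′ q ⟩
      P′ q                  ≡⟨ P′≡P q q≢s q≢t ⟩
      P q                   ≡⟨ lookup-⟦⟧ P q ⟨
      lookup ⟦ P ⟧ ⌜ q ⌝     ≡⟨ lookup∘update′ (q≢s ∘ ⌜⌝-injective) ⟦ P ⟧ outside ⟨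
      lookup S₁ ⌜ q ⌝        ≡⟨ lookup∘update′ (q≢t ∘ ⌜⌝-injective) S₁ inside ⟨
      lookup S′ ⌜ q ⌝        ∎
      where open ≡-Reasoning

  moveRobot : ∀ {P P′ : Vertex → Bool} {s t} → CoronaAdj' n s t →
    P s ≡ true → P t ≡ false → P′ s ≡ false → P′ t ≡ true → (∀ q → q ≢ s → q ≢ t → P′ q ≡ P q) →
    IsGeneralPosition G ⟦ P′ ⟧ → LegalMove G ⟦ P ⟧ ⟦ P′ ⟧
  moveRobot {P} {P′} {s} {t} s~t Ps Pt P′s P′t P′≡P P′-gp =
    ⌜ s ⌝ , ⌜ t ⌝ , adj {s} {t} s~t , ∈⟦⟧⁺ {P} {s} Ps , t∉P , ⟦⟧-moved {P} {P′} P′s P′t P′≡P , P′-gp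
    where
    t∉P : ¬ ⌜ t ⌝ ∈ ⟦ P ⟧
    t∉P t∈P with trans (sym (∈⟦⟧⁻ {P} {t} t∈P)) Pt
    ... | ()

  occupancy : Subset (n + n) → Fin n → ℕ
  occupancy T i = fromBool (lookup T ⌜ cyc i ⌝) + fromBool (lookup T ⌜ leaf i ⌝)

  ∣∣≡∑occupancy : ∀ T → ∣ T ∣ ≡ ∑[ i < n ] occupancy T i
  ∣∣≡∑occupancy T = begin
    ∣ T ∣                                                                  ≡⟨ ∣p∣≡∑ T ⟩
    ∑[ x < n + n ] fromBool (lookup T x)                                   ≡⟨ ∑-↑-split n (fromBool ∘ lookup T) ⟩
    ∑[ i < n ] fromBool (lookup T (i ↑ˡ n)) + ∑[ i < n ] fromBool (lookup T (n ↑ʳ i))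
                                                       ≡⟨ ∑-distrib-+ {n} (fromBool ∘ lookup T ∘ (_↑ˡ n)) _ ⟨
    ∑[ i < n ] occupancy T i                                               ∎
    where open ≡-Reasoning

  fin : ℕ → Fin n
  fin j = fromℕ< (m%n<n j n)

  toℕ-fin : ∀ {j} → j < n → toℕ (fin j) ≡ j
  toℕ-fin j<n = trans (toℕ-fromℕ< _) (m<n⇒m%n≡m j<n)

  fin-toℕ : ∀ i → fin (toℕ i) ≡ i
  fin-toℕ i = toℕ-injective (toℕ-fin (toℕ<n i))

  ∣∣≡∑occupancy-fin : ∀ T → ∣ T ∣ ≡ ∑[ i < n ] occupancy T (fin (toℕ i))
  ∣∣≡∑occupancy-fin T = trans (∣∣≡∑occupancy T) (sum-cong-≗ (λ i → cong (occupancy T) (sym (fin-toℕ i))))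

  occupant : ∀ T i → occupancy T i ≡ 0 ⊎ Σ Vertex λ s → pos s ≡ i × ⌜ s ⌝ ∈ T
  occupant T i with lookup T ⌜ cyc i ⌝ in c∈ | lookup T ⌜ leaf i ⌝ in l∈
  ... | inside  | _       = inj₂ (cyc i , refl , lookup⇒[]= _ T c∈)
  ... | outside | inside  = inj₂ (leaf i , refl , lookup⇒[]= _ T l∈)
  ... | outside | outside = inj₁ refl

  occupancy≤1 : ∀ T i → (⌜ cyc i ⌝ ∈ T → ⌜ leaf i ⌝ ∈ T → ⊥) → occupancy T i ≤ 1
  occupancy≤1 T i ¬both with lookup T ⌜ cyc i ⌝ in c∈ | lookup T ⌜ leaf i ⌝ in l∈
  ... | inside  | inside  = ⊥-elim (¬both (lookup⇒[]= _ T c∈) (lookup⇒[]= _ T l∈))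
  ... | inside  | outside = ≤-refl
  ... | outside | inside  = ≤-refl
  ... | outside | outside = z≤n

  occupancy≤2 : ∀ T i → occupancy T i ≤ 2
  occupancy≤2 T i = +-mono-≤ (fromBool≤1 (lookup T ⌜ cyc i ⌝)) (fromBool≤1 (lookup T ⌜ leaf i ⌝))

module Offsets (n : ℕ) (1<n : 1 < n) where

  open Corona n 1<n

  -- the position a − i (mod n) of vertex i in the frame of phase a
  offset : ℕ → Fin n → ℕ
  offset a i = (a + n ∸ toℕ i) % n

  offset<n : ∀ a i → offset a i < n
  offset<n a i = m%n<n _ n

  offset≡reflect : ∀ a i → offset a i ≡ reflect n (a % n) (toℕ i)
  offset≡reflect a i = begin
    (a + n ∸ toℕ i) % n                        ≡⟨ cong (_% n) a+n∸i≡ ⟩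
    ((a % n + n ∸ toℕ i) + (a / n) * n) % n    ≡⟨ [m+kn]%n≡m%n (a % n + n ∸ toℕ i) (a / n) n ⟩
    (a % n + n ∸ toℕ i) % n                    ≡⟨ reduced (toℕ i ≤? a % n) ⟩
    reflect n (a % n) (toℕ i)                  ∎
    where
    open ≡-Reasoning
    i≤n : toℕ i ≤ n
    i≤n = <⇒≤ (toℕ<n i)
    a+n∸i≡ : a + n ∸ toℕ i ≡ (a % n + n ∸ toℕ i) + (a / n) * n
    a+n∸i≡ = begin
      a + n ∸ toℕ i                          ≡⟨ +-∸-assoc a i≤n ⟩
      a + (n ∸ toℕ i)                        ≡⟨ cong (_+ (n ∸ toℕ i)) (m≡m%n+[m/n]*n a n) ⟩
      a % n + (a / n) * n + (n ∸ toℕ i)      ≡⟨ xy∙z≈xz∙y (a % n) _ _ ⟩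
      a % n + (n ∸ toℕ i) + (a / n) * n      ≡⟨ cong (_+ (a / n) * n) (+-∸-assoc (a % n) i≤n) ⟨
      (a % n + n ∸ toℕ i) + (a / n) * n      ∎
    reduced : Dec (toℕ i ≤ a % n) → (a % n + n ∸ toℕ i) % n ≡ reflect n (a % n) (toℕ i)
    reduced (yes i≤a) = begin
      (a % n + n ∸ toℕ i) % n    ≡⟨ cong (_% n) (+-∸-comm n i≤a) ⟩
      (a % n ∸ toℕ i + n) % n    ≡⟨ [m+n]%n≡m%n (a % n ∸ toℕ i) n ⟩
      (a % n ∸ toℕ i) % n        ≡⟨ m<n⇒m%n≡m (≤-<-trans (m∸n≤m (a % n) (toℕ i)) (m%n<n a n)) ⟩
      a % n ∸ toℕ i              ≡⟨ reflect-≤ n (a % n) (toℕ i) i≤a ⟨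
      reflect n (a % n) (toℕ i)  ∎
    reduced (no i≰a) = trans (cong (_% n) (sym (reflect-> n (a % n) (toℕ i) i≰a)))
                             (m<n⇒m%n≡m (reflect<n (m%n<n a n) (toℕ<n i)))

  a%n<n : ∀ a → a % n < n
  a%n<n a = m%n<n a n

  offset-injective : ∀ a {i j} → offset a i ≡ offset a j → i ≡ j
  offset-injective a {i} {j} eq = toℕ-injective (begin
    toℕ i                                                   ≡⟨ reflect-involutive (a%n<n a) (toℕ<n i) ⟨
    reflect n (a % n) (reflect n (a % n) (toℕ i))           ≡⟨ cong (reflect n (a % n)) reflections ⟩
    reflect n (a % n) (reflect n (a % n) (toℕ j))           ≡⟨ reflect-involutive (a%n<n a) (toℕ<n j) ⟩
    toℕ j                                                   ∎)
    where
    open ≡-Reasoning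
    reflections : reflect n (a % n) (toℕ i) ≡ reflect n (a % n) (toℕ j)
    reflections = trans (sym (offset≡reflect a i)) (trans eq (offset≡reflect a j))

  vertexAt : ℕ → (r : ℕ) → r < n → Fin n
  vertexAt a r r<n = fromℕ< (reflect<n (a%n<n a) r<n)

  toℕ-vertexAt : ∀ a r (r<n : r < n) → toℕ (vertexAt a r r<n) ≡ reflect n (a % n) r
  toℕ-vertexAt a r r<n = toℕ-fromℕ< _

  offset-vertexAt : ∀ a r (r<n : r < n) → offset a (vertexAt a r r<n) ≡ r
  offset-vertexAt a r r<n = begin
    offset a (vertexAt a r r<n)                 ≡⟨ offset≡reflect a (vertexAt a r r<n) ⟩
    reflect n (a % n) (toℕ (vertexAt a r r<n))  ≡⟨ cong (reflect n (a % n)) (toℕ-vertexAt a r r<n) ⟩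
    reflect n (a % n) (reflect n (a % n) r)     ≡⟨ reflect-involutive (a%n<n a) r<n ⟩
    r                                           ∎
    where open ≡-Reasoning

  ≢vertexAt : ∀ a {r} (r<n : r < n) {i} → i ≢ vertexAt a r r<n → offset a i ≢ r
  ≢vertexAt a r<n i≢ eq = i≢ (offset-injective a (trans eq (sym (offset-vertexAt a _ r<n))))

  dC-offset : ∀ a i j → dC i j ≡ cycDist n (offset a i) (offset a j)
  dC-offset a i j = sym (trans (cong₂ (cycDist n) (offset≡reflect a i) (offset≡reflect a j))
                               (cycDist-reflect (a%n<n a) (toℕ<n i) (toℕ<n j)))

  vertexAt-adjacent : ∀ a {r} (1+r<n : suc r < n) →
    CycAdj n (vertexAt a r (<⇒≤ 1+r<n)) (vertexAt a (suc r) 1+r<n)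
  vertexAt-adjacent a {r} 1+r<n = inj₂ edge , w≢w′
    where
    r<n = <⇒≤ 1+r<n
    w = vertexAt a r r<n
    w′ = vertexAt a (suc r) 1+r<n
    edge : CycEdge n (toℕ w′) (toℕ w)
    edge = subst₂ (CycEdge n) (sym (toℕ-vertexAt a (suc r) 1+r<n)) (sym (toℕ-vertexAt a r r<n)) (reflect-edge 1+r<n)
    w≢w′ : w ≢ w′
    w≢w′ w≡w′ = 1+n≢n (begin
      suc r          ≡⟨ offset-vertexAt a (suc r) 1+r<n ⟨
      offset a w′    ≡⟨ cong (offset a) w≡w′ ⟨
      offset a w     ≡⟨ offset-vertexAt a r r<n ⟩
      r              ∎)
      where open ≡-Reasoning

  offset-at : ∀ i {b} → b < n → offset (toℕ i + b) i ≡ b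
  offset-at i {b} b<n = begin
    (toℕ i + b + n ∸ toℕ i) % n   ≡⟨ cong (λ m → (m ∸ toℕ i) % n) (+-assoc (toℕ i) b n) ⟩
    (toℕ i + (b + n) ∸ toℕ i) % n ≡⟨ cong (_% n) (m+n∸m≡n (toℕ i) (b + n)) ⟩
    (b + n) % n                   ≡⟨ [m+n]%n≡m%n b n ⟩
    b % n                         ≡⟨ m<n⇒m%n≡m b<n ⟩
    b                             ∎
    where open ≡-Reasoning

  offset≤⇔ : ∀ {b} i → b < n → (offset b i ≤ b ⇔ toℕ i ≤ b)
  offset≤⇔ {b} i b<n = mk⇔ (λ off≤b → by-cases off≤b (toℕ i ≤? b))
                           (λ i≤b → subst (_≤ b) (sym (trans offset≡ (reflect-≤ n b (toℕ i) i≤b)))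
                                              (m∸n≤m b (toℕ i)))
    where
    offset≡ : offset b i ≡ reflect n b (toℕ i)
    offset≡ = trans (offset≡reflect b i) (cong (λ a → reflect n a (toℕ i)) (m<n⇒m%n≡m b<n))
    by-cases : offset b i ≤ b → Dec (toℕ i ≤ b) → toℕ i ≤ b
    by-cases _     (yes i≤b) = i≤b
    by-cases off≤b (no  i≰b) = ⊥-elim (<⇒≱ (begin-strict
      b                      <⟨ m<m+n b (m<n⇒0<n∸m (toℕ<n i)) ⟩
      b + (n ∸ toℕ i)        ≡⟨ +-∸-assoc b (<⇒≤ (toℕ<n i)) ⟨
      b + n ∸ toℕ i          ≡⟨ reflect-> n b (toℕ i) i≰b ⟨
      reflect n b (toℕ i)    ≡⟨ offset≡ ⟨
      offset b i             ∎) off≤b)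
      where open ≤-Reasoning

  offset-suc : ∀ a i → offset (suc a) i ≡ suc (offset a i) % n
  offset-suc a i = begin
    (suc a + n ∸ toℕ i) % n                   ≡⟨ cong (_% n) (+-∸-assoc 1 (≤-trans (<⇒≤ (toℕ<n i)) (m≤n+m n a))) ⟩
    (1 + (a + n ∸ toℕ i)) % n                 ≡⟨ %-distribˡ-+ 1 (a + n ∸ toℕ i) n ⟩
    (1 % n + offset a i) % n                  ≡⟨ cong (λ b → (b + offset a i) % n) (m<n⇒m%n≡m 1<n) ⟩
    suc (offset a i) % n                      ∎
    where open ≡-Reasoning

  offset-suc-last : ∀ a i → offset a i ≡ n ∸ 1 → offset (suc a) i ≡ 0
  offset-suc-last a i last = begin
    offset (suc a) i        ≡⟨ offset-suc a i ⟩
    suc (offset a i) % n    ≡⟨ cong (λ b → suc b % n) last ⟩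
    suc (n ∸ 1) % n         ≡⟨ cong (_% n) 1+n∸1≡n ⟩
    n % n                   ≡⟨ n%n≡0 n ⟩
    0                       ∎
    where open ≡-Reasoning

  offset-suc-≢last : ∀ a i → offset a i ≢ n ∸ 1 → offset (suc a) i ≡ suc (offset a i)
  offset-suc-≢last a i ≢last = trans (offset-suc a i) (m<n⇒m%n≡m 1+offset<n)
    where
    1+offset<n : suc (offset a i) < n
    1+offset<n with m≤n⇒m<n∨m≡n (offset<n a i)
    ... | inj₁ 1+offset<n = 1+offset<n
    ... | inj₂ 1+offset≡n = ⊥-elim (≢last (cong (_∸ 1) 1+offset≡n))

-- A mobile general position set of size h + 1

module LowerBound (n : ℕ) (1<n : 1 < n) where

  open Corona n 1<n
  open Offsets n 1<n
  open Moves G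

  arc : ℕ → Vertex → Bool
  arc a (cyc _)  = false
  arc a (leaf i) = does (offset a i ≤? h)

  arc+rover : ℕ → ℕ → Vertex → Bool
  arc+rover a r (cyc i)  = does (offset a i ≟ r)
  arc+rover a r (leaf i) = does (offset a i <? h)

  arc-gp : ∀ a → IsGeneralPosition G ⟦ arc a ⟧
  arc-gp a = generalPosition-if-noCycBetween ⟦ arc a ⟧ noCycBetween
    where
    noCycBetween : NoCycBetween ⟦ arc a ⟧
    noCycBetween {i = i} _ i∈arc with ∈⟦⟧⁻ {arc a} {cyc i} i∈arc
    ... | ()

  rover-offset : ∀ {a r i} → ⌜ cyc i ⌝ ∈ ⟦ arc+rover a r ⟧ → offset a i ≡ r
  rover-offset {a} {r} {i} i∈ = dec-true⁻¹ (offset a i ≟ r) (∈⟦⟧⁻ {arc+rover a r} {cyc i} i∈)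

  arc-offset : ∀ {a r i} → ⌜ leaf i ⌝ ∈ ⟦ arc+rover a r ⟧ → offset a i < h
  arc-offset {a} {r} {i} i∈ = dec-true⁻¹ (offset a i <? h) (∈⟦⟧⁻ {arc+rover a r} {leaf i} i∈)

  arc+rover-gp : ∀ a {r} → h ≤ r → r < n → IsGeneralPosition G ⟦ arc+rover a r ⟧
  arc+rover-gp a {r} h≤r r<n = generalPosition-if-noCycBetween ⟦ arc+rover a r ⟧ noCycBetween
    where
    unique : ∀ {i j} → ⌜ cyc i ⌝ ∈ ⟦ arc+rover a r ⟧ → ⌜ cyc j ⌝ ∈ ⟦ arc+rover a r ⟧ → cyc i ≡ cyc j
    unique i∈ j∈ = cong cyc (offset-injective a (trans (rover-offset i∈) (sym (rover-offset j∈))))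
    noCycBetween : NoCycBetween ⟦ arc+rover a r ⟧
    noCycBetween {cyc j}               j∈ i∈ _  j≢i _   _   _ = j≢i (unique j∈ i∈)
    noCycBetween {leaf j} {t = cyc k}  _  i∈ k∈ _   i≢k _   _ = i≢k (unique i∈ k∈)
    noCycBetween {leaf j} {i} {leaf k} j∈ i∈ k∈ _   _   j≢k between =
      <⇒≢ (cycDist-detour (arc-offset j∈) (arc-offset k∈) h≤r r<n (⌈n/2⌉+⌈n/2⌉≤1+n n)) (begin
        cycDist n (o j) (o k)                       ≡⟨ dC-offset a j k ⟨
        dC j k                                      ≡⟨ cyc-between-leaves (j≢k ∘ cong leaf) between ⟩
        dC j i + dC i k                             ≡⟨ cong₂ _+_ (dC-offset a j i) (dC-offset a i k) ⟩
        cycDist n (o j) (o i) + cycDist n (o i) (o k)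
                                                    ≡⟨ cong (λ x → cycDist n (o j) x + cycDist n x (o k)) (rover-offset i∈) ⟩
        cycDist n (o j) r + cycDist n r (o k)       ∎)
      where
      open ≡-Reasoning
      o = offset a

  descend : ∀ a → LegalMove G ⟦ arc a ⟧ ⟦ arc+rover a h ⟧
  descend a = moveRobot {arc a} {arc+rover a h} {leaf w} {cyc w} refl
    (dec-true (offset a w ≤? h) (≤-reflexive w-at-h)) refl
    (dec-false (offset a w <? h) (<-irrefl w-at-h)) (dec-true (offset a w ≟ h) w-at-h)
    unchanged (arc+rover-gp a ≤-refl h<n)
    where
    w = vertexAt a h h<n
    w-at-h = offset-vertexAt a h h<n
    unchanged : ∀ q → q ≢ leaf w → q ≢ cyc w → arc+rover a h q ≡ arc a q
    unchanged (cyc i)  _   i≢w = dec-false (offset a i ≟ h) (≢vertexAt a h<n (i≢w ∘ cong cyc))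
    unchanged (leaf i) i≢w _   = does-⇔ (mk⇔ <⇒≤ (λ i≤h → ≤∧≢⇒< i≤h (≢vertexAt a h<n (i≢w ∘ cong leaf))))
                                        (offset a i <? h) (offset a i ≤? h)

  advance : ∀ a {r} → h ≤ r → suc r < n → LegalMove G ⟦ arc+rover a r ⟧ ⟦ arc+rover a (suc r) ⟧
  advance a {r} h≤r 1+r<n = moveRobot {arc+rover a r} {arc+rover a (suc r)} {cyc w} {cyc w′} (vertexAt-adjacent a 1+r<n)
    (dec-true (offset a w ≟ r) w-at-r) (dec-false (offset a w′ ≟ r) (1+n≢n ∘ trans (sym w′-at-1+r)))
    (dec-false (offset a w ≟ suc r) (λ e → 1+n≢n (sym (trans (sym w-at-r) e)))) (dec-true (offset a w′ ≟ suc r) w′-at-1+r)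
    unchanged (arc+rover-gp a (≤-trans h≤r (n≤1+n r)) 1+r<n)
    where
    r<n = <⇒≤ 1+r<n
    w = vertexAt a r r<n
    w′ = vertexAt a (suc r) 1+r<n
    w-at-r = offset-vertexAt a r r<n
    w′-at-1+r = offset-vertexAt a (suc r) 1+r<n
    unchanged : ∀ q → q ≢ cyc w → q ≢ cyc w′ → arc+rover a (suc r) q ≡ arc+rover a r q
    unchanged (cyc i)  i≢w i≢w′ = trans (dec-false (offset a i ≟ suc r) (≢vertexAt a 1+r<n (i≢w′ ∘ cong cyc)))
                                        (sym (dec-false (offset a i ≟ r) (≢vertexAt a r<n (i≢w ∘ cong cyc))))
    unchanged (leaf i) _   _    = refl

  ascend : ∀ a {r} → r ≡ n ∸ 1 → LegalMove G ⟦ arc+rover a r ⟧ ⟦ arc (suc a) ⟧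
  ascend a refl = moveRobot {arc+rover a (n ∸ 1)} {arc (suc a)} {cyc w} {leaf w} refl
    (dec-true (offset a w ≟ n ∸ 1) w-at-last) (dec-false (offset a w <? h) (λ w<h → <⇒≱ w<h h≤w)) refl
    (dec-true (offset (suc a) w ≤? h) (≤-trans (≤-reflexive (offset-suc-last a w w-at-last)) z≤n))
    unchanged (arc-gp (suc a))
    where
    w = vertexAt a (n ∸ 1) n∸1<n
    w-at-last = offset-vertexAt a (n ∸ 1) n∸1<n
    h≤w : h ≤ offset a w
    h≤w = ≤-trans h≤n∸1 (≤-reflexive (sym w-at-last))
    unchanged : ∀ q → q ≢ cyc w → q ≢ leaf w → arc (suc a) q ≡ arc+rover a (n ∸ 1) q
    unchanged (cyc i)  i≢w _   = sym (dec-false (offset a i ≟ n ∸ 1) (≢vertexAt a n∸1<n (i≢w ∘ cong cyc)))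
    unchanged (leaf i) _   i≢w =
      cong (λ o → does (o ≤? h)) (offset-suc-≢last a i (≢vertexAt a n∸1<n (i≢w ∘ cong leaf)))

  around : ∀ a k {r} → r + k ≡ n ∸ 1 → h ≤ r → ∀ {L} → MoveSeq G ⟦ arc (suc a) ⟧ L →
    Σ (List (Subset (n + n))) λ L₀ → MoveSeq G ⟦ arc+rover a r ⟧ (L₀ ++ L)
  around a zero {r} r+0≡n∸1 _ moves =
    ⟦ arc+rover a r ⟧ ∷ [] , step (ascend a (trans (sym (+-identityʳ r)) r+0≡n∸1)) moves
  around a (suc k) {r} r+1+k≡n∸1 h≤r moves
    with around a k (trans (sym (+-suc r k)) r+1+k≡n∸1) (≤-trans h≤r (n≤1+n r)) moves
  ... | L₀ , moves′ = ⟦ arc+rover a r ⟧ ∷ L₀ , step (advance a h≤r 1+r<n) moves′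
    where
    1+r<n : suc r < n
    1+r<n = ≤-<-trans (≤-trans (s≤s (m≤m+n r k)) (≤-reflexive (trans (sym (+-suc r k)) r+1+k≡n∸1))) n∸1<n

  Visits : List (Subset (n + n)) → ℕ → Set
  Visits L a = ⟦ arc a ⟧ ∈ₗ L × ⟦ arc+rover a h ⟧ ∈ₗ L

  tour : ∀ k a → Σ (List (Subset (n + n))) λ L → MoveSeq G ⟦ arc a ⟧ L × (∀ j → j < k → Visits L (j + a))
  tour zero    a = ⟦ arc a ⟧ ∷ [] , done _ , λ _ ()
  tour (suc k) a with tour k (suc a)
  ... | L , moves , visited with around a (n ∸ 1 ∸ h) (m+[n∸m]≡n h≤n∸1) ≤-refl moves
  ... | L₀ , moves₀ = ⟦ arc a ⟧ ∷ L₀ ++ L , step (descend a) moves₀ , visited′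
    where
    visited′ : ∀ j → j < suc k → Visits (⟦ arc a ⟧ ∷ L₀ ++ L) (j + a)
    visited′ zero    _         = here refl , there (moveSeq-head moves₀ refl)
    visited′ (suc j) (s≤s j<k) rewrite sym (+-suc j a) with visited j j<k
    ... | arc∈L , rover∈L = there (++⁺ʳ L₀ arc∈L) , there (++⁺ʳ L₀ rover∈L)

  arc-mobile : IsMobileGP G ⟦ arc h ⟧
  arc-mobile with tour n h
  ... | L , moves , visited = arc-gp h , L , moves , everywhere
    where
    visit : ∀ {S x} → S ∈ₗ L → x ∈ S → Any (x ∈_) L
    visit S∈L x∈S = Any.map (λ { refl → x∈S }) S∈L
    covered : ∀ s → Any (⌜ s ⌝ ∈_) L
    covered (cyc i)  = visit (proj₂ (visited (toℕ i) (toℕ<n i)))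
      (∈⟦⟧⁺ {arc+rover (toℕ i + h) h} {cyc i} (dec-true (offset (toℕ i + h) i ≟ h) (offset-at i h<n)))
    covered (leaf i) = visit (proj₁ (visited (toℕ i) (toℕ<n i)))
      (∈⟦⟧⁺ {arc (toℕ i + h)} {leaf i} (dec-true (offset (toℕ i + h) i ≤? h) (≤-reflexive (offset-at i h<n))))
    everywhere : ∀ x → Any (x ∈_) L
    everywhere x = subst (λ y → Any (y ∈_) L) (⌜splitAt⌝ x) (covered (splitAt n x))

  arc-size : ∣ ⟦ arc h ⟧ ∣ ≡ h + 1
  arc-size = begin
    ∣ ⟦ arc h ⟧ ∣                                ≡⟨ ∣∣≡∑occupancy ⟦ arc h ⟧ ⟩
    ∑[ i < n ] occupancy ⟦ arc h ⟧ i             ≡⟨ sum-cong-≗ {n} arc-occupancy ⟩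
    ∑[ i < n ] fromBool (does (toℕ i ≤? h))      ≡⟨ ∑-indicator≤ h<n ⟩
    suc h                                        ≡⟨ +-comm 1 h ⟩
    h + 1                                        ∎
    where
    open ≡-Reasoning
    arc-occupancy : ∀ i → occupancy ⟦ arc h ⟧ i ≡ fromBool (does (toℕ i ≤? h))
    arc-occupancy i = cong₂ (λ c l → fromBool c + fromBool l) (lookup-⟦⟧ (arc h) (cyc i)) (trans
      (lookup-⟦⟧ (arc h) (leaf i)) (does-⇔ (offset≤⇔ i h<n) (offset h i ≤? h) (toℕ i ≤? h)))

-- General position sets through a cycle vertex

module UpperBound (n : ℕ) (1<n : 1 < n) where

  open Corona n 1<n

  0F : Fin n
  0F = fin 0

  toℕ-0F : toℕ 0F ≡ 0
  toℕ-0F = toℕ-fin 0<n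

  ≢0F : ∀ {j} → suc j < n → fin (suc j) ≢ 0F
  ≢0F 1+j<n eq = 1+n≢0 (trans (sym (toℕ-fin 1+j<n)) (trans (cong toℕ eq) toℕ-0F))

  <n∸1⇒1+<n : ∀ {j} → j < n ∸ 1 → suc j < n
  <n∸1⇒1+<n j<n∸1 = ≤-trans (s≤s j<n∸1) (≤-reflexive 1+n∸1≡n)

  module _ (T : Subset (n + n)) (T-gp : IsGeneralPosition G T) (c₀∈T : ⌜ cyc 0F ⌝ ∈ T) where

    c₀-not-between : ∀ {s t} → ⌜ s ⌝ ∈ T → ⌜ t ⌝ ∈ T → s ≢ cyc 0F → cyc 0F ≢ t → s ≢ t →
      dC (pos s) 0F + dC 0F (pos t) ≤ dC (pos s) (pos t) → ⊥
    c₀-not-between {s} {t} s∈T t∈T s≢c₀ c₀≢t s≢t detour =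
      ¬generalPosition-if-D-between T {s} {cyc 0F} {t} s∈T c₀∈T t∈T s≢c₀ c₀≢t s≢t
        (cyc-between {s} {t} 0F s≢t detour) T-gp

    single-per-position : ∀ i → i ≢ 0F → occupancy T i ≤ 1
    single-per-position i i≢0 = occupancy≤1 T i λ ci∈T li∈T →
      ¬generalPosition-if-D-between T {cyc 0F} {cyc i} {leaf i} c₀∈T ci∈T li∈T
        (≢-sym i≢0 ∘ inj₁-injective) (λ ()) (λ ())
        (cyc-between {cyc 0F} {leaf i} i (λ ()) (≤-reflexive (trans (cong (dC 0F i +_) (dC-refl i)) (+-identityʳ _))))
        T-gp

    l₀-alone : ⌜ leaf 0F ⌝ ∈ T → ∀ i → i ≢ 0F → occupancy T i ≡ 0
    l₀-alone l₀∈T i i≢0 with occupant T i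
    ... | inj₁ empty            = empty
    ... | inj₂ (s , refl , s∈T) = ⊥-elim (c₀-not-between {leaf 0F} {s} l₀∈T s∈T
                                    (λ ()) (≢-sym i≢0 ∘ cong pos) (≢-sym i≢0 ∘ cong pos)
                                    (≤-reflexive (cong (_+ dC 0F (pos s)) (dC-refl 0F))))

    antipodal-exclusive : ∀ j → h + j < n ∸ 1 → occupancy T (fin (suc j)) + occupancy T (fin (suc (h + j))) ≤ 1
    antipodal-exclusive j h+j<n∸1 = by-cases (occupant T near) (occupant T far)
      where
      near = fin (suc j)
      far = fin (suc (h + j))
      far<n : suc (h + j) < n
      far<n = <n∸1⇒1+<n h+j<n∸1
      near<n : suc j < n
      near<n = ≤-<-trans (s≤s (m≤n+m j h)) far<n
      toℕ-near : toℕ near ≡ suc j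
      toℕ-near = toℕ-fin near<n
      toℕ-far : toℕ far ≡ suc j + h
      toℕ-far = trans (toℕ-fin far<n) (cong suc (+-comm h j))
      1+j+h≤n : suc j + h ≤ n
      1+j+h≤n = ≤-trans (≤-reflexive (sym toℕ-far)) (<⇒≤ (toℕ<n far))
      near≢far : near ≢ far
      near≢far near≡far =
        <⇒≢ (m<m+n (suc j) (0<⌈n/2⌉ 0<n)) (trans (sym toℕ-near) (trans (cong toℕ near≡far) toℕ-far))
      detour : dC near 0F + dC 0F far ≤ dC near far
      detour = begin
        dC near 0F + dC 0F far                         ≡⟨ cong₂ _+_ (cong₂ (cycDist n) toℕ-near toℕ-0F)
                                                                    (cong₂ (cycDist n) toℕ-0F toℕ-far) ⟩
        cycDist n (suc j) 0 + cycDist n 0 (suc j + h)  ≤⟨ cycDist-via-0 {n} {suc j} {h} 1+j+h≤n (n≤⌈n/2⌉+⌈n/2⌉ n) ⟩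
        cycDist n (suc j) (suc j + h)                  ≡⟨ cong₂ (cycDist n) toℕ-near toℕ-far ⟨
        dC near far                                    ∎
        where open ≤-Reasoning
      by-cases : (occupancy T near ≡ 0 ⊎ Σ Vertex λ s → pos s ≡ near × ⌜ s ⌝ ∈ T) →
                 (occupancy T far ≡ 0 ⊎ Σ Vertex λ t → pos t ≡ far × ⌜ t ⌝ ∈ T) →
                 occupancy T near + occupancy T far ≤ 1
      by-cases (inj₁ near-empty) _ =
        ≤-trans (≤-reflexive (cong (_+ occupancy T far) near-empty)) (single-per-position far (≢0F far<n))
      by-cases _ (inj₁ far-empty) =
        ≤-trans (≤-reflexive (trans (cong (occupancy T near +_) far-empty) (+-identityʳ _)))
                (single-per-position near (≢0F near<n))
      by-cases (inj₂ (s , s-near , s∈T)) (inj₂ (t , t-far , t∈T)) = ⊥-elim (c₀-not-between {s} {t} s∈T t∈T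
        (≢0F near<n ∘ trans (sym s-near) ∘ cong pos) (≢0F far<n ∘ trans (sym t-far) ∘ sym ∘ cong pos)
        (λ s≡t → near≢far (trans (sym s-near) (trans (cong pos s≡t) t-far)))
        (subst₂ (λ a b → dC a 0F + dC 0F b ≤ dC a b) (sym s-near) (sym t-far) detour))

    ∣T∣≡ : ∣ T ∣ ≡ occupancy T 0F + ∑[ i < n ∸ 1 ] occupancy T (fin (suc (toℕ i)))
    ∣T∣≡ = trans (∣∣≡∑occupancy-fin T) (∑-peel (occupancy T ∘ fin) 0<n)

    size-if-l₀∈T : ⌜ leaf 0F ⌝ ∈ T → ∣ T ∣ ≤ h + 1
    size-if-l₀∈T l₀∈T = begin
      ∣ T ∣                                                                    ≡⟨ ∣T∣≡ ⟩
      occupancy T 0F + ∑[ i < n ∸ 1 ] occupancy T (fin (suc (toℕ i)))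
                                                                  ≤⟨ +-mono-≤ (occupancy≤2 T 0F) (∑-≤ _ others-empty) ⟩
      2 + (n ∸ 1) * 0                                                          ≡⟨ cong (2 +_) (*-zeroʳ (n ∸ 1)) ⟩
      2                                                                        ≤⟨ +-monoˡ-≤ 1 (0<⌈n/2⌉ 0<n) ⟩
      h + 1                                                                    ∎
      where
      open ≤-Reasoning
      others-empty : ∀ (i : Fin (n ∸ 1)) → occupancy T (fin (suc (toℕ i))) ≤ 0
      others-empty i = ≤-reflexive (l₀-alone l₀∈T _ (≢0F (<n∸1⇒1+<n (toℕ<n i))))

    size-if-l₀∉T : ¬ ⌜ leaf 0F ⌝ ∈ T → ∣ T ∣ ≤ h + 1
    size-if-l₀∉T l₀∉T = begin
      ∣ T ∣                                                                    ≡⟨ ∣T∣≡ ⟩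
      occupancy T 0F + ∑[ i < n ∸ 1 ] occupancy T (fin (suc (toℕ i)))
        ≤⟨ +-mono-≤ (occupancy≤1 T 0F (λ _ l₀∈T → l₀∉T l₀∈T))
                    (∑-pairing≤ (occupancy T ∘ fin ∘ suc) h≤n∸1 (≤-trans (m∸n≤m n 1) (n≤⌈n/2⌉+⌈n/2⌉ n))
                                (λ j j<n∸1 → single-per-position _ (≢0F (<n∸1⇒1+<n j<n∸1)))
                                antipodal-exclusive) ⟩
      1 + h                                                                    ≡⟨ +-comm 1 h ⟩
      h + 1                                                                    ∎
      where open ≤-Reasoning

    size-bound : ∣ T ∣ ≤ h + 1
    size-bound with ⌜ leaf 0F ⌝ ∈? T
    ... | yes l₀∈T = size-if-l₀∈T l₀∈T
    ... | no  l₀∉T = size-if-l₀∉T l₀∉T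

theorem4p3 : (n : ℕ) → 3 ≤ n → MobEq (CnCoronaK1 n) (⌈ n /2⌉ + 1)
theorem4p3 n 3≤n = (⟦ arc h ⟧ , arc-mobile , arc-size) , mobile-size-bound ⌜ cyc 0F ⌝ (h + 1) size-bound
  where
  1<n = ≤-trans (n≤1+n 2) 3≤n
  open Corona n 1<n
  open LowerBound n 1<n
  open UpperBound n 1<n
  open Moves G
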